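{- Let $k\ge 2$ be an integer. Among all mixed Abelian Cayley graphs $\mathrm{Cay}(\Gamma,\Sigma)$ with diameter $k$ whose generating set has the form $\Sigma=\{b,\pm a_1,\pm a_2\}$, where $b$ is an involution, $a_1,a_2$ are not involutions, and $b,a_1,-a_1,a_2,-a_2$ are pairwise distinct (so $r_{\alpha}=1$, $r_{\omega}=2$, $z_{\omega}=0$), the maximum order $|\Gamma|$ is $N=4k^2$, and this maximum is attained by the graph $\mathrm{Cay}(\mathbb{Z}_N,\{\pm 1,\pm(2k-1),2k^2\})$ with $N=4k^2$.
   Context: For an Abelian group $\Gamma$ and generating set $\Sigma$, the Cayley graph $\mathrm{Cay}(\Gamma,\Sigma)$ has vertex set $\Gamma$ and an arc from $g$ to $g+a$ for each $g\in\Gamma$, $a\in\Sigma$; a pair of opposite arcs (when $a,-a\in\Sigma$ or $a$ is an involution) is regarded as an undirected edge, giving a mixed graph. The distance from $u$ to $v$ is the length of a shortest directed path from $u$ to $v$, and the diameter is the maximum distance over all ordered pairs of vertices. -}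

module Defs where

open import Level using (Level; _⊔_; 0ℓ)
open import Data.Nat as ℕ using (ℕ; zero; suc; _≤_)
open import Data.Fin using (Fin)
import Data.Fin as F
open import Data.List using (List; []; _∷_; length)
open import Data.Product using (Σ; ∃; ∃-syntax; _×_; _,_)
open import Relation.Nullary using (¬_)
open import Relation.Binary.PropositionalEquality as P using (_≡_; refl; cong; cong₂)
open import Algebra.Bundles using (AbelianGroup)
open import Algebra.Structures using (IsAbelianGroup)
import Data.Integer as Z
open import Data.Integer using (ℤ; +_)
open import Data.Integer.Tactic.RingSolver using (solve-∀)
import Data.Integer.Properties

record FiniteAbelianGroup (c ℓ : Level) : Set (Level.suc (c ⊔ ℓ)) where
  field
    abGroup     : AbelianGroup c ℓ
  open AbelianGroup abGroup public
  field
    order       : ℕ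
    enum        : Fin order → Carrier
    enum-inj    : ∀ i j → enum i ≈ enum j → i ≡ j
    enum-surj   : ∀ x → ∃[ i ] (enum i ≈ x)

module Cayley {c ℓ} (G : AbelianGroup c ℓ) where
  open AbelianGroup G

  gen : Carrier → Carrier → Carrier → Fin 5 → Carrier
  gen b a₁ a₂ F.zero = b
  gen b a₁ a₂ (F.suc F.zero) = a₁
  gen b a₁ a₂ (F.suc (F.suc F.zero)) = a₁ ⁻¹
  gen b a₁ a₂ (F.suc (F.suc (F.suc F.zero))) = a₂
  gen b a₁ a₂ (F.suc (F.suc (F.suc (F.suc F.zero)))) = a₂ ⁻¹

  endpoint : (Fin 5 → Carrier) → Carrier → List (Fin 5) → Carrier
  endpoint s u [] = u
  endpoint s u (i ∷ w) = endpoint s (u ∙ s i) w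

  DistLe : (Fin 5 → Carrier) → ℕ → Carrier → Carrier → Set ℓ
  DistLe s ℓ' u v = ∃[ w ] (length w ≤ ℓ' × endpoint s u w ≈ v)

  HasDiameter : (Fin 5 → Carrier) → ℕ → Set (c ⊔ ℓ)
  HasDiameter s k =
    (∀ u v → DistLe s k u v) × (∃[ u ] ∃[ v ] ¬ DistLe s (k ℕ.∸ 1) u v)

  IsInvolution : Carrier → Set ℓ
  IsInvolution x = (¬ x ≈ ε) × (x ∙ x ≈ ε)

  Admissible : Carrier → Carrier → Carrier → Set ℓ
  Admissible b a₁ a₂ =
    IsInvolution b × ¬ IsInvolution a₁ × ¬ IsInvolution a₂ ×
    (∀ i j → gen b a₁ a₂ i ≈ gen b a₁ a₂ j → i ≡ j)

-- The cyclic group ℤ_N, realised as ℤ with equality "congruent mod N".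

_≡[mod_]_ : ℤ → ℕ → ℤ → Set
x ≡[mod N ] y = ∃[ q ] (x ≡ y Z.+ q Z.* (+ N))

private
  open Z using (_+_; _*_; -_)

  e-sym : ∀ y q n → y ≡ (y + q * n) + (- q) * n
  e-sym = solve-∀
  e-trans : ∀ z p q n → (z + q * n) + p * n ≡ z + (q + p) * n
  e-trans = solve-∀
  e-cong : ∀ y v p q n → (y + p * n) + (v + q * n) ≡ (y + v) + (p + q) * n
  e-cong = solve-∀
  e-assoc : ∀ x y z n → (x + y) + z ≡ (x + (y + z)) + + 0 * n
  e-assoc = solve-∀
  e-idl : ∀ x n → + 0 + x ≡ x + + 0 * n
  e-idl = solve-∀
  e-idr : ∀ x n → x + + 0 ≡ x + + 0 * n
  e-idr = solve-∀
  e-invl : ∀ x n → (- x) + x ≡ + 0 + + 0 * n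
  e-invl = solve-∀
  e-invr : ∀ x n → x + (- x) ≡ + 0 + + 0 * n
  e-invr = solve-∀
  e-neg : ∀ y p n → - (y + p * n) ≡ (- y) + (- p) * n
  e-neg = solve-∀
  e-comm : ∀ x y n → x + y ≡ (y + x) + + 0 * n
  e-comm = solve-∀

ℤ-mod-abelianGroup : ℕ → AbelianGroup 0ℓ 0ℓ
ℤ-mod-abelianGroup N = record
  { Carrier = ℤ
  ; _≈_ = λ x y → x ≡[mod N ] y
  ; _∙_ = Z._+_
  ; ε = + 0
  ; _⁻¹ = Z.-_
  ; isAbelianGroup = record
    { isGroup = record
      { isMonoid = record
        { isSemigroup = record
          { isMagma = record
            { isEquivalence = record
              { refl = λ {x} → + 0 , e-idr' x
              ; sym = λ { {x} {y} (q , refl) → Z.- q , e-sym y q n }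
              ; trans = λ { {x} {y} {z} (p , refl) (q , refl) → q Z.+ p , e-trans z p q n }
              }
            ; ∙-cong = λ { {x} {y} {u} {v} (p , refl) (q , refl) → p Z.+ q , e-cong y v p q n }
            }
          ; assoc = λ x y z → + 0 , e-assoc x y z n
          }
        ; identity = (λ x → + 0 , e-idl x n) , (λ x → + 0 , e-idr x n)
        }
      ; inverse = (λ x → + 0 , e-invl x n) , (λ x → + 0 , e-invr x n)
      ; ⁻¹-cong = λ { {x} {y} (p , refl) → Z.- p , e-neg y p n }
      }
    ; comm = λ x y → + 0 , e-comm x y n
    }
  }
  where
  n = + N
  e-idr' : ∀ x → x ≡ x Z.+ + 0 Z.* n
  e-idr' x = P.trans (P.sym (Data.Integer.Properties.+-identityʳ x)) (e-idr x n)

-- ℤ_N as a finite Abelian group is not needed: its order N is by definition.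

module Submission where

-- Every element of Γ is e b + x a₁ + y a₂ for a code (e, x, y) of norm [e] + |x| + |y| ≤ k, and
-- there are 4k² + 2 such codes.  Translation by the involution b pairs up the elements of Γ, so
-- |Γ| is even, and |Γ| ≤ 4k² follows unless every element has exactly one short code.  In that
-- perfect case the relations form a lattice L ⊆ ℤ² with a coset C (the points evaluating to b);
-- L meets the ℓ₁-ball of radius 2k only in 0, C avoids the ball of radius 2k - 1, and 0 and b are
-- the only elements of order two.  Each point w of the sphere of radius k then has an antipode c
-- of norm k with w - c ∈ C, and the antipodes of (k - 1, ±1) and (±1, k - 1) yield two points of
-- C whose half-sum t satisfies 0 < ‖t‖ < 2k, which is impossible.
-- In Cay(ℤ_{4k²}, {±1, ±(2k - 1), 2k²}) a code has value ≡ x - y modulo 2k, so reaching k needs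
-- k steps, while every residue is given an explicit code of norm at most k.

module TaxicabNorm where
  open import Algebra.Properties.CommutativeSemigroup as CommSemigroupProperties using ()
  open import Data.Integer as ℤ using (ℤ; +_; -[1+_]; ∣_∣; _+_; _-_; -_)
  import Data.Integer.Properties as ℤₚ
  open import Data.Nat as ℕ using (ℕ; zero; suc; _≤_; _⊓_; _∸_)
  import Data.Nat.Properties as ℕₚ
  open import Data.Product using (∃-syntax; ∃₂; _×_; _,_)
  open import Data.Sum using (_⊎_; inj₁; inj₂)
  open import Relation.Binary.PropositionalEquality using (_≡_; refl; sym; trans; cong; cong₂; module ≡-Reasoning)
  import Data.Integer.Tactic.RingSolver as ℤ-Ring

  open CommSemigroupProperties ℕₚ.+-commutativeSemigroup using () renaming (interchange to +-interchange)

  ‖_,_‖₁ : ℤ → ℤ → ℕ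
  ‖ x , y ‖₁ = ∣ x ∣ ℕ.+ ∣ y ∣

  ‖+‖≤ : ∀ x y x′ y′ → ‖ x + x′ , y + y′ ‖₁ ≤ ‖ x , y ‖₁ ℕ.+ ‖ x′ , y′ ‖₁
  ‖+‖≤ x y x′ y′ = ℕₚ.≤-trans
    (ℕₚ.+-mono-≤ (ℤₚ.∣i+j∣≤∣i∣+∣j∣ x x′) (ℤₚ.∣i+j∣≤∣i∣+∣j∣ y y′))
    (ℕₚ.≤-reflexive (+-interchange (∣ x ∣) (∣ x′ ∣) (∣ y ∣) (∣ y′ ∣)))

  x+x≡0⇒x≡0 : ∀ x → x + x ≡ + 0 → x ≡ + 0
  x+x≡0⇒x≡0 (+ zero)  _  = refl
  x+x≡0⇒x≡0 (+ suc n) ()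
  x+x≡0⇒x≡0 -[1+ n ]  ()

  ∸-+-∸ : ∀ a b A → (a ∸ A) ℕ.+ (b ∸ (A ∸ a)) ≡ (a ℕ.+ b) ∸ A
  ∸-+-∸ zero    b zero    = refl
  ∸-+-∸ (suc a) b zero    = refl
  ∸-+-∸ zero    b (suc A) = refl
  ∸-+-∸ (suc a) b (suc A) = ∸-+-∸ a b A

  clamp : ∀ A x → ∃₂ λ u v → x ≡ u - v × ∣ u ∣ ≡ A ⊓ ∣ x ∣ × ∣ v ∣ ≡ ∣ x ∣ ∸ A
  clamp A (+ n) = + (A ⊓ n) , - + (n ∸ A) , eq , refl , ℤₚ.∣-i∣≡∣i∣ (+ (n ∸ A))
    where
    eq : + n ≡ + (A ⊓ n) - - + (n ∸ A)
    eq = begin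
      + n                               ≡⟨ cong +_ (ℕₚ.m⊓n+n∸m≡n A n) ⟨
      + (A ⊓ n) + + (n ∸ A)             ≡⟨ cong (_+_ (+ (A ⊓ n))) (ℤₚ.neg-involutive (+ (n ∸ A))) ⟨
      + (A ⊓ n) - - + (n ∸ A)           ∎
      where open ≡-Reasoning
  clamp A -[1+ n ] with clamp A (+ suc n)
  ... | u , v , eq , ∣u∣ , ∣v∣ = - u , - v , trans (cong -_ eq) (neg-minus u v) ,
        trans (ℤₚ.∣-i∣≡∣i∣ u) ∣u∣ , trans (ℤₚ.∣-i∣≡∣i∣ v) ∣v∣
    where
    neg-minus : ∀ u v → - (u - v) ≡ - u - - v
    neg-minus = ℤ-Ring.solve-∀

  ℓ₁-split : ∀ A B x y → ‖ x , y ‖₁ ≤ A ℕ.+ B →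
    ∃₂ λ u₁ u₂ → ∃₂ λ v₁ v₂ → ‖ u₁ , u₂ ‖₁ ≤ A × ‖ v₁ , v₂ ‖₁ ≤ B × x ≡ u₁ - v₁ × y ≡ u₂ - v₂
  ℓ₁-split A B x y ‖x‖≤A+B
    with u₁ , v₁ , x≡ , ∣u₁∣ , ∣v₁∣ ← clamp A x
       | u₂ , v₂ , y≡ , ∣u₂∣ , ∣v₂∣ ← clamp (A ∸ ∣ x ∣) y
    = u₁ , u₂ , v₁ , v₂ , ‖u‖≤A , ‖v‖≤B , x≡ , y≡
    where
    open ℕₚ.≤-Reasoning
    ‖u‖≤A : ‖ u₁ , u₂ ‖₁ ≤ A
    ‖u‖≤A = begin
      ∣ u₁ ∣ ℕ.+ ∣ u₂ ∣                       ≡⟨ cong₂ ℕ._+_ (trans ∣u₁∣ (ℕₚ.⊓-comm A ∣ x ∣)) ∣u₂∣ ⟩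
      ∣ x ∣ ⊓ A ℕ.+ (A ∸ ∣ x ∣) ⊓ ∣ y ∣      ≤⟨ ℕₚ.+-monoʳ-≤ (∣ x ∣ ⊓ A) (ℕₚ.m⊓n≤m (A ∸ ∣ x ∣) ∣ y ∣) ⟩
      ∣ x ∣ ⊓ A ℕ.+ (A ∸ ∣ x ∣)              ≡⟨ ℕₚ.m⊓n+n∸m≡n ∣ x ∣ A ⟩
      A                                       ∎
    ‖v‖≤B : ‖ v₁ , v₂ ‖₁ ≤ B
    ‖v‖≤B = begin
      ∣ v₁ ∣ ℕ.+ ∣ v₂ ∣                       ≡⟨ cong₂ ℕ._+_ ∣v₁∣ ∣v₂∣ ⟩
      (∣ x ∣ ∸ A) ℕ.+ (∣ y ∣ ∸ (A ∸ ∣ x ∣))  ≡⟨ ∸-+-∸ ∣ x ∣ ∣ y ∣ A ⟩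
      ‖ x , y ‖₁ ∸ A                           ≤⟨ ℕₚ.m≤n+o⇒m∸n≤o ‖ x , y ‖₁ A ‖x‖≤A+B ⟩
      B                                       ∎

  positive-coordinate-slack : ∀ c a → (∃[ n ] c ≡ - + n) ⊎ (2 ℕ.+ ∣ c - + suc a ∣ ≤ ∣ c ∣ ℕ.+ suc a)
  positive-coordinate-slack (+ zero)  a = inj₁ (0 , refl)
  positive-coordinate-slack -[1+ n ]  a = inj₁ (suc n , refl)
  positive-coordinate-slack (+ suc q) a = inj₂ (begin
    2 ℕ.+ ∣ suc q ℤ.⊖ suc a ∣   ≡⟨ cong (λ z → 2 ℕ.+ ∣ z ∣) (ℤₚ.[1+m]⊖[1+n]≡m⊖n q a) ⟩
    2 ℕ.+ ∣ q ℤ.⊖ a ∣           ≤⟨ ℕₚ.+-monoʳ-≤ 2 (ℕₚ.≤-trans (ℤₚ.∣m⊝n∣≤m⊔n q a) (ℕₚ.m⊔n≤m+n q a)) ⟩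
    2 ℕ.+ (q ℕ.+ a)             ≡⟨ cong suc (ℕₚ.+-suc q a) ⟨
    suc q ℕ.+ suc a             ∎)
    where open ℕₚ.≤-Reasoning

  ℓ₁-strict-triangle : ∀ x y x′ y′ →
    (2 ℕ.+ ∣ x - x′ ∣ ≤ ∣ x ∣ ℕ.+ ∣ x′ ∣) ⊎ (2 ℕ.+ ∣ y - y′ ∣ ≤ ∣ y ∣ ℕ.+ ∣ y′ ∣) →
    2 ℕ.+ ‖ x - x′ , y - y′ ‖₁ ≤ ‖ x , y ‖₁ ℕ.+ ‖ x′ , y′ ‖₁
  ℓ₁-strict-triangle x y x′ y′ slack = begin
    2 ℕ.+ (∣ x - x′ ∣ ℕ.+ ∣ y - y′ ∣)        ≤⟨ coordinatewise slack ⟩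
    (∣ x ∣ ℕ.+ ∣ x′ ∣) ℕ.+ (∣ y ∣ ℕ.+ ∣ y′ ∣) ≡⟨ +-interchange (∣ x ∣) (∣ x′ ∣) (∣ y ∣) (∣ y′ ∣) ⟩
    ‖ x , y ‖₁ ℕ.+ ‖ x′ , y′ ‖₁              ∎
    where
    open ℕₚ.≤-Reasoning
    coordinatewise : (2 ℕ.+ ∣ x - x′ ∣ ≤ ∣ x ∣ ℕ.+ ∣ x′ ∣) ⊎ (2 ℕ.+ ∣ y - y′ ∣ ≤ ∣ y ∣ ℕ.+ ∣ y′ ∣) →
                     2 ℕ.+ (∣ x - x′ ∣ ℕ.+ ∣ y - y′ ∣) ≤ (∣ x ∣ ℕ.+ ∣ x′ ∣) ℕ.+ (∣ y ∣ ℕ.+ ∣ y′ ∣)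
    coordinatewise (inj₁ slack₁) = ℕₚ.+-mono-≤ slack₁ (ℤₚ.∣i-j∣≤∣i∣+∣j∣ y y′)
    coordinatewise (inj₂ slack₂) = ℕₚ.≤-trans
      (ℕₚ.≤-reflexive (sym (trans (ℕₚ.+-suc ∣ x - x′ ∣ _) (cong suc (ℕₚ.+-suc ∣ x - x′ ∣ _)))))
      (ℕₚ.+-mono-≤ (ℤₚ.∣i-j∣≤∣i∣+∣j∣ x x′) slack₂)

module Codes where
  open TaxicabNorm
  open import Data.Bool using (Bool; true; false; _xor_)
  open import Data.Bool.Properties using (xor-assoc)
  open import Data.Fin using (Fin)
  open import Data.Fin.Patterns using (0F; 1F; 2F; 3F; 4F)
  open import Data.List using (List; []; _∷_; _++_; length; replicate)
  import Data.List.Properties as Listₚ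
  open import Data.Integer using (ℤ; +_; -[1+_]; ∣_∣; _+_; -_)
  import Data.Integer.Properties as ℤₚ
  open import Data.Nat as ℕ using (ℕ; zero; suc; _≤_; z≤n; s≤s)
  import Data.Nat.Properties as ℕₚ
  open import Relation.Binary.PropositionalEquality using (_≡_; refl; sym; trans; cong; cong₂; module ≡-Reasoning)

  record Code : Set where
    constructor code
    field
      withB  : Bool
      coeff₁ : ℤ
      coeff₂ : ℤ

  infixl 6 _⊕_
  infix 8 ⊖_

  _⊕_ : Code → Code → Code
  code e x y ⊕ code e′ x′ y′ = code (e xor e′) (x + x′) (y + y′)

  ⊖_ : Code → Code
  ⊖ code e x y = code e (- x) (- y)

  ‖_‖ : Code → ℕ
  ‖ code false x y ‖ = ‖ x , y ‖₁
  ‖ code true  x y ‖ = suc ‖ x , y ‖₁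

  ‖⊕‖≤ : ∀ c d → ‖ c ⊕ d ‖ ≤ ‖ c ‖ ℕ.+ ‖ d ‖
  ‖⊕‖≤ (code false x y) (code false x′ y′) = ‖+‖≤ x y x′ y′
  ‖⊕‖≤ (code false x y) (code true  x′ y′) =
    ℕₚ.≤-trans (s≤s (‖+‖≤ x y x′ y′)) (ℕₚ.≤-reflexive (sym (ℕₚ.+-suc _ _)))
  ‖⊕‖≤ (code true  x y) (code false x′ y′) = s≤s (‖+‖≤ x y x′ y′)
  ‖⊕‖≤ (code true  x y) (code true  x′ y′) =
    ℕₚ.≤-trans (‖+‖≤ x y x′ y′) (ℕₚ.+-mono-≤ (ℕₚ.n≤1+n _) (ℕₚ.n≤1+n _))

  ‖⊖‖ : ∀ c → ‖ ⊖ c ‖ ≡ ‖ c ‖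
  ‖⊖‖ (code false x y) = cong₂ ℕ._+_ (ℤₚ.∣-i∣≡∣i∣ x) (ℤₚ.∣-i∣≡∣i∣ y)
  ‖⊖‖ (code true  x y) = cong suc (cong₂ ℕ._+_ (ℤₚ.∣-i∣≡∣i∣ x) (ℤₚ.∣-i∣≡∣i∣ y))

  0ᶜ : Code
  0ᶜ = code false (+ 0) (+ 0)

  ⊕-identityˡ : ∀ c → 0ᶜ ⊕ c ≡ c
  ⊕-identityˡ (code e x y) = cong₂ (code e) (ℤₚ.+-identityˡ x) (ℤₚ.+-identityˡ y)

  ⊕-assoc : ∀ c d e → (c ⊕ d) ⊕ e ≡ c ⊕ (d ⊕ e)
  ⊕-assoc (code e x y) (code e′ x′ y′) (code e″ x″ y″)
    rewrite xor-assoc e e′ e″ | ℤₚ.+-assoc x x′ x″ | ℤₚ.+-assoc y y′ y″ = refl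

  step : Fin 5 → Code
  step 0F = code true  (+ 0)   (+ 0)
  step 1F = code false (+ 1)   (+ 0)
  step 2F = code false (- + 1) (+ 0)
  step 3F = code false (+ 0)   (+ 1)
  step 4F = code false (+ 0)   (- + 1)

  codeOf : List (Fin 5) → Code
  codeOf []      = 0ᶜ
  codeOf (i ∷ w) = step i ⊕ codeOf w

  codeOf-++ : ∀ w w′ → codeOf (w ++ w′) ≡ codeOf w ⊕ codeOf w′
  codeOf-++ []      w′ = sym (⊕-identityˡ (codeOf w′))
  codeOf-++ (i ∷ w) w′ = trans (cong (step i ⊕_) (codeOf-++ w w′)) (sym (⊕-assoc (step i) (codeOf w) (codeOf w′)))

  ‖codeOf‖≤length : ∀ w → ‖ codeOf w ‖ ≤ length w
  ‖codeOf‖≤length []      = z≤n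
  ‖codeOf‖≤length (i ∷ w) = ℕₚ.≤-trans (‖⊕‖≤ (step i) (codeOf w)) (ℕₚ.+-mono-≤ (‖step‖≤1 i) (‖codeOf‖≤length w))
    where
    ‖step‖≤1 : ∀ i → ‖ step i ‖ ≤ 1
    ‖step‖≤1 0F = ℕₚ.≤-refl
    ‖step‖≤1 1F = ℕₚ.≤-refl
    ‖step‖≤1 2F = ℕₚ.≤-refl
    ‖step‖≤1 3F = ℕₚ.≤-refl
    ‖step‖≤1 4F = ℕₚ.≤-refl

  signedSteps : ℤ → Fin 5 → Fin 5 → List (Fin 5)
  signedSteps (+ n)    i i⁻ = replicate n i
  signedSteps -[1+ n ] i i⁻ = replicate (suc n) i⁻

  bSteps : Bool → List (Fin 5)
  bSteps false = []
  bSteps true  = 0F ∷ []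

  walk : Code → List (Fin 5)
  walk (code e x y) = bSteps e ++ (signedSteps x 1F 2F ++ signedSteps y 3F 4F)

  length-walk : ∀ c → length (walk c) ≡ ‖ c ‖
  length-walk (code false x y) = length-steps x y
    where
    length-signedSteps : ∀ z i i⁻ → length (signedSteps z i i⁻) ≡ ∣ z ∣
    length-signedSteps (+ n)    _ _ = Listₚ.length-replicate n
    length-signedSteps -[1+ n ] _ _ = Listₚ.length-replicate (suc n)
    length-steps : ∀ x y → length (signedSteps x 1F 2F ++ signedSteps y 3F 4F) ≡ ‖ x , y ‖₁
    length-steps x y = trans (Listₚ.length-++ (signedSteps x 1F 2F))
                             (cong₂ ℕ._+_ (length-signedSteps x 1F 2F) (length-signedSteps y 3F 4F))
  length-walk (code true x y) = cong suc (length-walk (code false x y))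

  codeOf-walk : ∀ c → codeOf (walk c) ≡ c
  codeOf-walk (code e x y) = begin
    codeOf (bSteps e ++ (signedSteps x 1F 2F ++ signedSteps y 3F 4F))
      ≡⟨ codeOf-++ (bSteps e) _ ⟩
    codeOf (bSteps e) ⊕ codeOf (signedSteps x 1F 2F ++ signedSteps y 3F 4F)
      ≡⟨ cong (codeOf (bSteps e) ⊕_) (codeOf-++ (signedSteps x 1F 2F) _) ⟩
    codeOf (bSteps e) ⊕ (codeOf (signedSteps x 1F 2F) ⊕ codeOf (signedSteps y 3F 4F))
      ≡⟨ cong₂ (λ c d → codeOf (bSteps e) ⊕ (c ⊕ d)) (codeOf-a₁-steps x) (codeOf-a₂-steps y) ⟩
    codeOf (bSteps e) ⊕ (code false (x + + 0) (+ 0 + y))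
      ≡⟨ cong (codeOf (bSteps e) ⊕_) (cong₂ (code false) (ℤₚ.+-identityʳ x) (ℤₚ.+-identityˡ y)) ⟩
    codeOf (bSteps e) ⊕ code false x y
      ≡⟨ add-b e ⟩
    code e x y ∎
    where
    open ≡-Reasoning
    codeOf-a₁-steps : ∀ x → codeOf (signedSteps x 1F 2F) ≡ code false x (+ 0)
    codeOf-a₁-steps (+ zero)       = refl
    codeOf-a₁-steps (+ suc n)      = cong (step 1F ⊕_) (codeOf-a₁-steps (+ n))
    codeOf-a₁-steps -[1+ zero ]    = refl
    codeOf-a₁-steps -[1+ suc n ]   = cong (step 2F ⊕_) (codeOf-a₁-steps -[1+ n ])
    codeOf-a₂-steps : ∀ y → codeOf (signedSteps y 3F 4F) ≡ code false (+ 0) y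
    codeOf-a₂-steps (+ zero)       = refl
    codeOf-a₂-steps (+ suc n)      = cong (step 3F ⊕_) (codeOf-a₂-steps (+ n))
    codeOf-a₂-steps -[1+ zero ]    = refl
    codeOf-a₂-steps -[1+ suc n ]   = cong (step 4F ⊕_) (codeOf-a₂-steps -[1+ n ])
    add-b : ∀ e → codeOf (bSteps e) ⊕ code false x y ≡ code e x y
    add-b false = ⊕-identityˡ (code false x y)
    add-b true  = cong₂ (code true) (ℤₚ.+-identityˡ x) (ℤₚ.+-identityˡ y)

module PerfectCodes where
  open TaxicabNorm
  open Codes
  open import Data.Bool using (true; false)
  open import Data.Empty using (⊥; ⊥-elim)
  open import Data.Integer using (ℤ; +_; ∣_∣; _+_; _-_; -_)
  import Data.Integer.Properties as ℤₚ
  open import Data.Nat as ℕ using (ℕ; zero; suc; _≤_; _<_; z≤n; s≤s)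
  import Data.Nat.Properties as ℕₚ
  open import Data.Product using (∃-syntax; ∃₂; _×_; _,_; proj₂)
  open import Data.Sum using (_⊎_; inj₁; inj₂)
  open import Function using (_∘_)
  open import Relation.Nullary using (¬_)
  open import Relation.Binary.PropositionalEquality using (_≡_; _≢_; refl; sym; trans; cong; cong₂; subst; subst₂; module ≡-Reasoning)
  import Data.Integer.Tactic.RingSolver as ℤ-Ring
  import Data.Nat.Tactic.RingSolver as ℕ-Ring

  open import Algebra.Properties.CommutativeSemigroup ℕₚ.+-commutativeSemigroup using () renaming (interchange to +-interchange)

  -- K plays the role of the set of relations {c | val c = 0}: the codes of norm at most k
  -- then form a complete and irredundant system of representatives of Code modulo K.
  record PerfectCode {ℓ} (k : ℕ) (K : Code → Set ℓ) : Set ℓ where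
    field
      K-⊕      : ∀ {c d} → K c → K d → K (c ⊕ d)
      K-⊖      : ∀ {c} → K c → K (⊖ c)
      K-unique : ∀ {c d} → ‖ c ‖ ≤ k → ‖ d ‖ ≤ k → K (c ⊕ ⊖ d) → c ≡ d
      K-cover  : ∀ t → ∃[ c ] (‖ c ‖ ≤ k × K (c ⊕ ⊖ t))

  -- The lattice L K = {(x, y) | x a₁ + y a₂ = 0} and its coset C K = {(x, y) | x a₁ + y a₂ = b}.
  L C : ∀ {ℓ} → (Code → Set ℓ) → ℤ → ℤ → Set ℓ
  L K x y = K (code false x y)
  C K x y = K (code true x y)

  module PerfectCodeProperties {ℓ m} {K : Code → Set ℓ} (P : PerfectCode (2 ℕ.+ m) K) where
    open PerfectCode P

    k : ℕ
    k = 2 ℕ.+ m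

    L-short⇒0 : ∀ {x y} → L K x y → ‖ x , y ‖₁ ≤ k ℕ.+ k → x ≡ + 0 × y ≡ + 0
    L-short⇒0 {x} {y} Lxy ‖x‖≤2k
      with u₁ , u₂ , v₁ , v₂ , ‖u‖≤k , ‖v‖≤k , refl , refl ← ℓ₁-split k k x y ‖x‖≤2k
      with refl ← K-unique {code false u₁ u₂} {code false v₁ v₂} ‖u‖≤k ‖v‖≤k Lxy
      = ℤₚ.+-inverseʳ u₁ , ℤₚ.+-inverseʳ u₂

    C-far : ∀ {x y} → C K x y → k ℕ.+ k ≤ ‖ x , y ‖₁
    C-far {x} {y} Cxy = ℕₚ.≮⇒≥ near-impossible
      where
      near-impossible : ‖ x , y ‖₁ < k ℕ.+ k → ⊥
      near-impossible ‖x‖<2k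
        with u₁ , u₂ , v₁ , v₂ , ‖u‖<k , ‖v‖≤k , refl , refl ← ℓ₁-split (suc m) k x y (ℕₚ.≤-pred ‖x‖<2k)
        with () ← K-unique {code true u₁ u₂} {code false v₁ v₂} (s≤s ‖u‖<k) ‖v‖≤k Cxy

    C-separated : ∀ {x y x′ y′} → C K x y → C K x′ y′ → ‖ x - x′ , y - y′ ‖₁ ≤ k ℕ.+ k →
                  x ≡ x′ × y ≡ y′
    C-separated {x} {y} {x′} {y′} Cp Cq ‖p-q‖≤2k
      with x-x′≡0 , y-y′≡0 ← L-short⇒0 (K-⊕ Cp (K-⊖ Cq)) ‖p-q‖≤2k
      = ℤₚ.i-j≡0⇒i≡j x x′ x-x′≡0 , ℤₚ.i-j≡0⇒i≡j y y′ y-y′≡0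

    private
      twice : ∀ c t → c - t + (c - t) + (t + t) ≡ c + c
      twice = ℤ-Ring.solve-∀

      neg-0-minus : ∀ t → - (+ 0 - t) ≡ t
      neg-0-minus = ℤ-Ring.solve-∀

      representative-of-half : ∀ {e t₁ t₂} c₁ c₂ → ‖ c₁ , c₂ ‖₁ ≤ k →
        K (code e (c₁ - t₁) (c₂ - t₂)) →
        L K (c₁ - t₁ + (c₁ - t₁) + (t₁ + t₁)) (c₂ - t₂ + (c₂ - t₂) + (t₂ + t₂)) →
        K (code e t₁ t₂)
      representative-of-half {e} {t₁} {t₂} c₁ c₂ ‖c‖≤k Kc-t L2c
        with 2c₁≡0 , 2c₂≡0 ← L-short⇒0 (subst₂ (L K) (twice c₁ t₁) (twice c₂ t₂) L2c)
                                       (ℕₚ.≤-trans (‖+‖≤ c₁ c₂ c₁ c₂) (ℕₚ.+-mono-≤ ‖c‖≤k ‖c‖≤k))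
        with refl ← x+x≡0⇒x≡0 c₁ 2c₁≡0 | refl ← x+x≡0⇒x≡0 c₂ 2c₂≡0
        = subst₂ (λ x y → K (code e x y)) (neg-0-minus t₁) (neg-0-minus t₂) (K-⊖ Kc-t)

    -- The only elements of order two are 0 and b.
    L-halves : ∀ {t₁ t₂} → L K (t₁ + t₁) (t₂ + t₂) → L K t₁ t₂ ⊎ C K t₁ t₂
    L-halves {t₁} {t₂} L2t with K-cover (code false t₁ t₂)
    ... | code false c₁ c₂ , ‖c‖≤k , Kc-t =
          inj₁ (representative-of-half c₁ c₂ ‖c‖≤k Kc-t (K-⊕ (K-⊕ Kc-t Kc-t) L2t))
    ... | code true  c₁ c₂ , ‖c‖<k , Kc-t =
          inj₂ (representative-of-half c₁ c₂ (ℕₚ.<⇒≤ ‖c‖<k) Kc-t (K-⊕ (K-⊕ Kc-t Kc-t) L2t))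

    C-no-short-midpoint : ∀ x y x′ y′ t₁ t₂ → C K x y → C K x′ y′ →
      x + x′ ≡ t₁ + t₁ → y + y′ ≡ t₂ + t₂ → 0 < ‖ t₁ , t₂ ‖₁ → ‖ t₁ , t₂ ‖₁ < k ℕ.+ k → ⊥
    C-no-short-midpoint _ _ _ _ t₁ t₂ Cp Cq x≡2t₁ y≡2t₂ ‖t‖>0 ‖t‖<2k
      with L-halves (subst₂ (L K) x≡2t₁ y≡2t₂ (K-⊕ Cp Cq))
    ... | inj₂ Ct = ℕₚ.<⇒≱ ‖t‖<2k (C-far Ct)
    ... | inj₁ Lt with refl , refl ← L-short⇒0 {t₁} {t₂} Lt (ℕₚ.<⇒≤ ‖t‖<2k) = ℕₚ.<-irrefl refl ‖t‖>0

    antipode : ∀ {w₁ w₂} → ‖ w₁ , w₂ ‖₁ ≡ k →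
      ∃₂ λ c₁ c₂ → ‖ c₁ , c₂ ‖₁ ≤ k × C K (c₁ - w₁) (c₂ - w₂)
    antipode {w₁} {w₂} ‖w‖≡k with K-cover (code true w₁ w₂)
    ... | code false c₁ c₂ , ‖c‖≤k , Cc-w = c₁ , c₂ , ‖c‖≤k , Cc-w
    ... | code true  c₁ c₂ , ‖c‖<k , Lc-w
      with refl ← K-unique {code false c₁ c₂} {code false w₁ w₂} (ℕₚ.<⇒≤ ‖c‖<k) (ℕₚ.≤-reflexive ‖w‖≡k) Lc-w
      = ⊥-elim (ℕₚ.<-irrefl ‖w‖≡k ‖c‖<k)

    private
      no-triangle-slack : ∀ {c₁ c₂ w₁ w₂} → ‖ c₁ , c₂ ‖₁ ≤ k → ‖ w₁ , w₂ ‖₁ ≡ k →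
        C K (c₁ - w₁) (c₂ - w₂) → ¬ (2 ℕ.+ ‖ c₁ - w₁ , c₂ - w₂ ‖₁ ≤ ‖ c₁ , c₂ ‖₁ ℕ.+ ‖ w₁ , w₂ ‖₁)
      no-triangle-slack {c₁} {c₂} {w₁} {w₂} ‖c‖≤k ‖w‖≡k Cc-w slack = ℕₚ.1+n≰n (begin
        suc (k ℕ.+ k)                          ≤⟨ ℕₚ.n≤1+n _ ⟩
        2 ℕ.+ (k ℕ.+ k)                        ≤⟨ ℕₚ.+-monoʳ-≤ 2 (C-far Cc-w) ⟩
        2 ℕ.+ ‖ c₁ - w₁ , c₂ - w₂ ‖₁            ≤⟨ slack ⟩
        ‖ c₁ , c₂ ‖₁ ℕ.+ ‖ w₁ , w₂ ‖₁           ≤⟨ ℕₚ.+-mono-≤ ‖c‖≤k (ℕₚ.≤-reflexive ‖w‖≡k) ⟩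
        k ℕ.+ k                                ∎)
        where open ℕₚ.≤-Reasoning

      reflect : ∀ n w → - (- n - w) ≡ w + n
      reflect = ℤ-Ring.solve-∀

    quadrant-antipode : ∀ a b → suc a ℕ.+ suc b ≡ k →
      ∃₂ λ n₁ n₂ → n₁ ℕ.+ n₂ ≡ k × C K (+ (suc a ℕ.+ n₁)) (+ (suc b ℕ.+ n₂))
    quadrant-antipode a b ‖w‖≡k
      with c₁ , c₂ , ‖c‖≤k , Cc-w ← antipode {+ suc a} {+ suc b} ‖w‖≡k
      with positive-coordinate-slack c₁ a | positive-coordinate-slack c₂ b
    ... | inj₂ slack₁ | _ = ⊥-elim (no-triangle-slack {c₁} {c₂} ‖c‖≤k ‖w‖≡k Cc-w
                                      (ℓ₁-strict-triangle c₁ c₂ (+ suc a) (+ suc b) (inj₁ slack₁)))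
    ... | inj₁ _ | inj₂ slack₂ = ⊥-elim (no-triangle-slack {c₁} {c₂} ‖c‖≤k ‖w‖≡k Cc-w
                                      (ℓ₁-strict-triangle c₁ c₂ (+ suc a) (+ suc b) (inj₂ slack₂)))
    ... | inj₁ (n₁ , refl) | inj₁ (n₂ , refl) = n₁ , n₂ , ℕₚ.≤-antisym n≤k k≤n , Cp
      where
      open ℕₚ.≤-Reasoning
      Cp : C K (+ (suc a ℕ.+ n₁)) (+ (suc b ℕ.+ n₂))
      Cp = subst₂ (C K) (reflect (+ n₁) (+ suc a)) (reflect (+ n₂) (+ suc b)) (K-⊖ Cc-w)
      n≤k : n₁ ℕ.+ n₂ ≤ k
      n≤k = subst (_≤ k) (cong₂ ℕ._+_ (ℤₚ.∣-i∣≡∣i∣ (+ n₁)) (ℤₚ.∣-i∣≡∣i∣ (+ n₂))) ‖c‖≤k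
      k≤n : k ≤ n₁ ℕ.+ n₂
      k≤n = ℕₚ.+-cancelˡ-≤ k k (n₁ ℕ.+ n₂) (begin
        k ℕ.+ k                                 ≤⟨ C-far Cp ⟩
        (suc a ℕ.+ n₁) ℕ.+ (suc b ℕ.+ n₂)       ≡⟨ +-interchange (suc a) n₁ (suc b) n₂ ⟩
        (suc a ℕ.+ suc b) ℕ.+ (n₁ ℕ.+ n₂)       ≡⟨ cong (ℕ._+ (n₁ ℕ.+ n₂)) ‖w‖≡k ⟩
        k ℕ.+ (n₁ ℕ.+ n₂)                       ∎)

  record IsCodeSymmetry (ρ : Code → Code) : Set where
    field
      ρ-⊕          : ∀ c d → ρ (c ⊕ d) ≡ ρ c ⊕ ρ d
      ρ-⊖          : ∀ c → ρ (⊖ c) ≡ ⊖ ρ c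
      ρ-involutive : ∀ c → ρ (ρ c) ≡ c
      ρ-‖‖         : ∀ c → ‖ ρ c ‖ ≡ ‖ c ‖

  perfect-∘ : ∀ {ℓ k} {K : Code → Set ℓ} {ρ} → IsCodeSymmetry ρ → PerfectCode k K → PerfectCode k (K ∘ ρ)
  perfect-∘ {k = k} {K} {ρ} ρ-sym P = record
    { K-⊕      = λ {c} {d} Kρc Kρd → subst K (sym (ρ-⊕ c d)) (K-⊕ Kρc Kρd)
    ; K-⊖      = λ {c} Kρc → subst K (sym (ρ-⊖ c)) (K-⊖ Kρc)
    ; K-unique = unique
    ; K-cover  = cover
    }
    where
    open IsCodeSymmetry ρ-sym
    open PerfectCode P

    ρ-⊕⊖ : ∀ c d → ρ (c ⊕ ⊖ d) ≡ ρ c ⊕ ⊖ ρ d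
    ρ-⊕⊖ c d = trans (ρ-⊕ c (⊖ d)) (cong (ρ c ⊕_) (ρ-⊖ d))

    unique : ∀ {c d} → ‖ c ‖ ≤ k → ‖ d ‖ ≤ k → K (ρ (c ⊕ ⊖ d)) → c ≡ d
    unique {c} {d} ‖c‖≤k ‖d‖≤k Kρ[c-d] = begin
      c       ≡⟨ ρ-involutive c ⟨
      ρ (ρ c) ≡⟨ cong ρ (K-unique (subst (_≤ k) (sym (ρ-‖‖ c)) ‖c‖≤k) (subst (_≤ k) (sym (ρ-‖‖ d)) ‖d‖≤k)
                           (subst K (ρ-⊕⊖ c d) Kρ[c-d])) ⟩
      ρ (ρ d) ≡⟨ ρ-involutive d ⟩
      d       ∎
      where open ≡-Reasoning

    cover : ∀ t → ∃[ c ] (‖ c ‖ ≤ k × K (ρ (c ⊕ ⊖ t)))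
    cover t with c , ‖c‖≤k , Kc-ρt ← K-cover (ρ t) =
      ρ c , subst (_≤ k) (sym (ρ-‖‖ c)) ‖c‖≤k ,
      subst K (sym (trans (ρ-⊕⊖ (ρ c) t) (cong (_⊕ ⊖ ρ t) (ρ-involutive c)))) Kc-ρt

  swap flip : Code → Code
  swap (code e x y) = code e y x
  flip (code e x y) = code e x (- y)

  swap-symmetry : IsCodeSymmetry swap
  swap-symmetry = record
    { ρ-⊕          = λ { (code _ _ _) (code _ _ _) → refl }
    ; ρ-⊖          = λ { (code _ _ _) → refl }
    ; ρ-involutive = λ { (code _ _ _) → refl }
    ; ρ-‖‖         = λ { (code false x y) → ℕₚ.+-comm ∣ y ∣ ∣ x ∣
                       ; (code true  x y) → cong suc (ℕₚ.+-comm ∣ y ∣ ∣ x ∣) }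
    }

  flip-symmetry : IsCodeSymmetry flip
  flip-symmetry = record
    { ρ-⊕          = λ { (code _ _ y) (code _ _ y′) → cong (code _ _) (ℤₚ.neg-distrib-+ y y′) }
    ; ρ-⊖          = λ { (code _ _ _) → refl }
    ; ρ-involutive = λ { (code _ _ y) → cong (code _ _) (ℤₚ.neg-involutive y) }
    ; ρ-‖‖         = λ { (code false x y) → cong (∣ x ∣ ℕ.+_) (ℤₚ.∣-i∣≡∣i∣ y)
                       ; (code true  x y) → cong (suc ∘ (∣ x ∣ ℕ.+_)) (ℤₚ.∣-i∣≡∣i∣ y) }
    }

  -- The antipodes of (k - 1, 1) and (k - 1, -1) are too close to each other unless one of them
  -- lies on the line x = k - 1.
  axis-neighbour : ∀ {ℓ m} {K : Code → Set ℓ} → PerfectCode (2 ℕ.+ m) K →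
    C K (+ suc m) (+ (3 ℕ.+ m)) ⊎ C K (+ suc m) (- + (3 ℕ.+ m))
  axis-neighbour {m = m} {K} P
    with PerfectCodeProperties.quadrant-antipode P m 0 (ℕₚ.+-comm (suc m) 1)
       | PerfectCodeProperties.quadrant-antipode (perfect-∘ flip-symmetry P) m 0 (ℕₚ.+-comm (suc m) 1)
  ... | zero , _ , refl , Cp | _ =
        inj₁ (subst (λ x → C K x (+ (3 ℕ.+ m))) (cong +_ (ℕₚ.+-identityʳ (suc m))) Cp)
  ... | suc _ , _ , _ , _ | zero , _ , refl , Cp′ =
        inj₂ (subst (λ x → C K x (- + (3 ℕ.+ m))) (cong +_ (ℕₚ.+-identityʳ (suc m))) Cp′)
  ... | suc n₁ , n₂ , n≡k , Cp | suc m₁ , m₂ , m≡k , Cp′ =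
        ⊥-elim (positive≢negative (proj₂ (PerfectCodeProperties.C-separated P Cp Cp′ close)))
    where
    positive≢negative : + suc n₂ ≢ - + suc m₂
    positive≢negative ()
    open ℕₚ.≤-Reasoning
    cancel : ∀ M N A → M + (+ 1 + N) - (M + (+ 1 + A)) ≡ N - A
    cancel = ℤ-Ring.solve-∀
    close : ‖ + (suc m ℕ.+ suc n₁) - + (suc m ℕ.+ suc m₁) , + suc n₂ - - + suc m₂ ‖₁ ≤ (2 ℕ.+ m) ℕ.+ (2 ℕ.+ m)
    close = begin
      ∣ + (suc m ℕ.+ suc n₁) - + (suc m ℕ.+ suc m₁) ∣ ℕ.+ (suc n₂ ℕ.+ suc m₂)
        ≡⟨ cong (λ z → ∣ z ∣ ℕ.+ (suc n₂ ℕ.+ suc m₂)) (cancel (+ suc m) (+ n₁) (+ m₁)) ⟩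
      ∣ + n₁ - + m₁ ∣ ℕ.+ (suc n₂ ℕ.+ suc m₂)
        ≤⟨ ℕₚ.+-monoˡ-≤ _ (ℤₚ.∣i-j∣≤∣i∣+∣j∣ (+ n₁) (+ m₁)) ⟩
      (n₁ ℕ.+ m₁) ℕ.+ (suc n₂ ℕ.+ suc m₂)
        ≡⟨ regroup n₁ m₁ n₂ m₂ ⟩
      (suc n₁ ℕ.+ n₂) ℕ.+ (suc m₁ ℕ.+ m₂)
        ≡⟨ cong₂ ℕ._+_ n≡k m≡k ⟩
      (2 ℕ.+ m) ℕ.+ (2 ℕ.+ m) ∎
      where
      regroup : ∀ a b c d → (a ℕ.+ b) ℕ.+ (suc c ℕ.+ suc d) ≡ (suc a ℕ.+ c) ℕ.+ (suc b ℕ.+ d)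
      regroup = ℕ-Ring.solve-∀

  -- In each of the four cases two points of C have a half-sum t with 0 < ‖t‖ < 2k.
  no-perfect-code : ∀ {ℓ m} {K : Code → Set ℓ} → ¬ PerfectCode (2 ℕ.+ m) K
  no-perfect-code {m = m} {K} P = incompatible (axis-neighbour P) (axis-neighbour (perfect-∘ swap-symmetry P))
    where
    open PerfectCode P
    open PerfectCodeProperties P

    M : ℤ
    M = + m
    k+1<2k : suc k < k ℕ.+ k
    k+1<2k = s≤s (s≤s (ℕₚ.m≤n+m k m))
    2<2k : 2 < k ℕ.+ k
    2<2k = ℕₚ.≤-trans (s≤s (s≤s (s≤s z≤n))) k+1<2k

    r₁ : ∀ M → + 1 + M + - (+ 3 + M) ≡ - + 1 + - + 1
    r₁ = ℤ-Ring.solve-∀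
    r₂ : ∀ M → + 3 + M + - (+ 1 + M) ≡ + 1 + + 1
    r₂ = ℤ-Ring.solve-∀
    r₃ : ∀ M → - (+ 3 + M) + (+ 1 + M) ≡ - + 1 + - + 1
    r₃ = ℤ-Ring.solve-∀
    r₄ : ∀ M → + 3 + M + (+ 1 + M) ≡ + 2 + M + (+ 2 + M)
    r₄ = ℤ-Ring.solve-∀
    r₅ : ∀ M → + 1 + M + (+ 3 + M) ≡ + 2 + M + (+ 2 + M)
    r₅ = ℤ-Ring.solve-∀

    incompatible : C K (+ suc m) (+ (3 ℕ.+ m)) ⊎ C K (+ suc m) (- + (3 ℕ.+ m)) →
                   C K (+ (3 ℕ.+ m)) (+ suc m) ⊎ C K (- + (3 ℕ.+ m)) (+ suc m) → ⊥
    incompatible (inj₁ Cp) (inj₁ Cq) =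
      C-no-short-midpoint (+ suc m) (+ (3 ℕ.+ m)) (- + (3 ℕ.+ m)) (- + suc m) (- + 1) (+ 1)
        Cp (K-⊖ Cq) (r₁ M) (r₂ M) (s≤s z≤n) 2<2k
    incompatible (inj₂ Cp) (inj₂ Cq) =
      C-no-short-midpoint (+ suc m) (- + (3 ℕ.+ m)) (- + (3 ℕ.+ m)) (+ suc m) (- + 1) (- + 1)
        Cp Cq (r₁ M) (r₃ M) (s≤s z≤n) 2<2k
    incompatible (inj₁ Cp) (inj₂ Cq) =
      C-no-short-midpoint (+ suc m) (+ (3 ℕ.+ m)) (- + (3 ℕ.+ m)) (+ suc m) (- + 1) (+ k)
        Cp Cq (r₁ M) (r₄ M) (s≤s z≤n) k+1<2k
    incompatible (inj₂ Cp) (inj₁ Cq) =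
      C-no-short-midpoint (+ suc m) (- + (3 ℕ.+ m)) (+ (3 ℕ.+ m)) (+ suc m) (+ k) (- + 1)
        Cp Cq (r₅ M) (r₃ M) (s≤s z≤n) (subst (_< k ℕ.+ k) (ℕₚ.+-comm 1 k) k+1<2k)

module GroupEvaluation where
  open Codes
  open import Defs using (module Cayley)
  open import Algebra.Bundles using (AbelianGroup)
  open import Data.Bool using (Bool; true; false; _xor_)
  open import Data.Fin.Patterns using (0F; 1F; 2F; 3F; 4F)
  open import Data.Integer using (ℤ; +_; -[1+_]; _+_; -_; _⊖_)
  import Data.Integer.Properties as ℤₚ
  open import Data.List using ([]; _∷_)
  open import Data.Nat as ℕ using (ℕ; zero; suc; _≤_)
  import Data.Nat.Properties as ℕₚ
  open import Data.Product using (∃-syntax; _×_; _,_)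
  open import Relation.Binary.PropositionalEquality as ≡ using (_≡_)

  module IntegerMultiples {c ℓ} (G : AbelianGroup c ℓ) where
    open AbelianGroup G
    open import Algebra.Properties.AbelianGroup G
    open import Algebra.Properties.Monoid.Mult monoid using (×-homo-+) renaming (_×_ to _×ᵐ_)
    open import Relation.Binary.Reasoning.Setoid setoid

    infixr 8 _·_
    _·_ : ℤ → Carrier → Carrier
    (+ n)    · a = n ×ᵐ a
    -[1+ n ] · a = (suc n ×ᵐ a) ⁻¹

    ·-⊖ : ∀ m n a → (m ⊖ n) · a ≈ m ×ᵐ a ∙ (n ×ᵐ a) ⁻¹
    ·-⊖ zero    zero    a = sym (inverseʳ ε)
    ·-⊖ zero    (suc n) a = sym (identityˡ _)
    ·-⊖ (suc m) zero    a = begin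
      suc m ×ᵐ a            ≈⟨ identityʳ _ ⟨
      suc m ×ᵐ a ∙ ε        ≈⟨ ∙-congˡ ε⁻¹≈ε ⟨
      suc m ×ᵐ a ∙ ε ⁻¹     ∎
    ·-⊖ (suc m) (suc n) a = begin
      (suc m ⊖ suc n) · a                        ≡⟨ ≡.cong (_· a) (ℤₚ.[1+m]⊖[1+n]≡m⊖n m n) ⟩
      (m ⊖ n) · a                                ≈⟨ ·-⊖ m n a ⟩
      m ×ᵐ a ∙ (n ×ᵐ a) ⁻¹                         ≈⟨ xyx⁻¹≈y a _ ⟨
      a ∙ (m ×ᵐ a ∙ (n ×ᵐ a) ⁻¹) ∙ a ⁻¹            ≈⟨ ∙-congʳ (assoc _ _ _) ⟨
      a ∙ m ×ᵐ a ∙ (n ×ᵐ a) ⁻¹ ∙ a ⁻¹              ≈⟨ assoc _ _ _ ⟩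
      suc m ×ᵐ a ∙ ((n ×ᵐ a) ⁻¹ ∙ a ⁻¹)            ≈⟨ ∙-congˡ (⁻¹-∙-comm _ _) ⟩
      suc m ×ᵐ a ∙ (n ×ᵐ a ∙ a) ⁻¹                 ≈⟨ ∙-congˡ (⁻¹-cong (comm _ _)) ⟩
      suc m ×ᵐ a ∙ (suc n ×ᵐ a) ⁻¹                 ∎

    ·-homo-+ : ∀ i j a → (i + j) · a ≈ i · a ∙ j · a
    ·-homo-+ (+ m)    (+ n)    a = ×-homo-+ a m n
    ·-homo-+ (+ m)    -[1+ n ] a = ·-⊖ m (suc n) a
    ·-homo-+ -[1+ m ] (+ n)    a = trans (·-⊖ n (suc m) a) (comm _ _)
    ·-homo-+ -[1+ m ] -[1+ n ] a = begin
      (suc (suc (m ℕ.+ n)) ×ᵐ a) ⁻¹       ≡⟨ ≡.cong (λ z → (suc z ×ᵐ a) ⁻¹) (ℕₚ.+-suc m n) ⟨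
      ((suc m ℕ.+ suc n) ×ᵐ a) ⁻¹         ≈⟨ ⁻¹-cong (×-homo-+ a (suc m) (suc n)) ⟩
      (suc m ×ᵐ a ∙ suc n ×ᵐ a) ⁻¹         ≈⟨ ⁻¹-∙-comm _ _ ⟨
      (suc m ×ᵐ a) ⁻¹ ∙ (suc n ×ᵐ a) ⁻¹    ∎

    ·-homo-neg : ∀ i a → (- i) · a ≈ (i · a) ⁻¹
    ·-homo-neg (+ zero)  a = sym ε⁻¹≈ε
    ·-homo-neg (+ suc n) a = refl
    ·-homo-neg -[1+ n ]  a = sym (⁻¹-involutive _)

  module Evaluation {c ℓ} (G : AbelianGroup c ℓ) (b a₁ a₂ : AbelianGroup.Carrier G)
                    (b∙b≈ε : AbelianGroup._≈_ G (AbelianGroup._∙_ G b b) (AbelianGroup.ε G)) where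
    open AbelianGroup G
    open import Algebra.Properties.AbelianGroup G
    open import Algebra.Properties.CommutativeSemigroup commutativeSemigroup using (interchange)
    open import Relation.Binary.Reasoning.Setoid setoid
    open IntegerMultiples G
    open Cayley G

    bPart : Bool → Carrier
    bPart false = ε
    bPart true  = b

    val : Code → Carrier
    val (code e x y) = bPart e ∙ (x · a₁ ∙ y · a₂)

    private
      bPart-xor : ∀ e e′ → bPart (e xor e′) ≈ bPart e ∙ bPart e′
      bPart-xor false e′    = sym (identityˡ _)
      bPart-xor true  false = sym (identityʳ b)
      bPart-xor true  true  = sym b∙b≈ε

      bPart-⁻¹ : ∀ e → bPart e ≈ bPart e ⁻¹
      bPart-⁻¹ false = sym ε⁻¹≈ε
      bPart-⁻¹ true  = inverseʳ-unique b b b∙b≈ε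

    val-⊕ : ∀ c d → val (c ⊕ d) ≈ val c ∙ val d
    val-⊕ (code e x y) (code e′ x′ y′) = begin
      bPart (e xor e′) ∙ ((x + x′) · a₁ ∙ (y + y′) · a₂)
        ≈⟨ ∙-cong (bPart-xor e e′) (∙-cong (·-homo-+ x x′ a₁) (·-homo-+ y y′ a₂)) ⟩
      (bPart e ∙ bPart e′) ∙ ((x · a₁ ∙ x′ · a₁) ∙ (y · a₂ ∙ y′ · a₂))
        ≈⟨ ∙-congˡ (interchange _ _ _ _) ⟩
      (bPart e ∙ bPart e′) ∙ ((x · a₁ ∙ y · a₂) ∙ (x′ · a₁ ∙ y′ · a₂))
        ≈⟨ interchange _ _ _ _ ⟩
      (bPart e ∙ (x · a₁ ∙ y · a₂)) ∙ (bPart e′ ∙ (x′ · a₁ ∙ y′ · a₂)) ∎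

    val-⊖ : ∀ c → val (⊖ c) ≈ val c ⁻¹
    val-⊖ (code e x y) = begin
      bPart e ∙ ((- x) · a₁ ∙ (- y) · a₂)
        ≈⟨ ∙-cong (bPart-⁻¹ e) (∙-cong (·-homo-neg x a₁) (·-homo-neg y a₂)) ⟩
      bPart e ⁻¹ ∙ ((x · a₁) ⁻¹ ∙ (y · a₂) ⁻¹)  ≈⟨ ∙-congˡ (⁻¹-∙-comm _ _) ⟩
      bPart e ⁻¹ ∙ (x · a₁ ∙ y · a₂) ⁻¹         ≈⟨ ⁻¹-∙-comm _ _ ⟩
      (bPart e ∙ (x · a₁ ∙ y · a₂)) ⁻¹          ∎

    val-step : ∀ i → val (step i) ≈ gen b a₁ a₂ i
    val-step 0F = trans (∙-congˡ (identityˡ ε)) (identityʳ b)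
    val-step 1F = trans (identityˡ _) (trans (identityʳ _) (identityʳ a₁))
    val-step 2F = trans (identityˡ _) (trans (identityʳ _) (⁻¹-cong (identityʳ a₁)))
    val-step 3F = trans (identityˡ _) (trans (identityˡ _) (identityʳ a₂))
    val-step 4F = trans (identityˡ _) (trans (identityˡ _) (⁻¹-cong (identityʳ a₂)))

    endpoint-codeOf : ∀ u w → endpoint (gen b a₁ a₂) u w ≈ u ∙ val (codeOf w)
    endpoint-codeOf u []      = sym (trans (∙-congˡ (trans (identityˡ _) (identityˡ ε))) (identityʳ u))
    endpoint-codeOf u (i ∷ w) = begin
      endpoint (gen b a₁ a₂) (u ∙ gen b a₁ a₂ i) w  ≈⟨ endpoint-codeOf (u ∙ gen b a₁ a₂ i) w ⟩
      u ∙ gen b a₁ a₂ i ∙ val (codeOf w)            ≈⟨ assoc _ _ _ ⟩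
      u ∙ (gen b a₁ a₂ i ∙ val (codeOf w))          ≈⟨ ∙-congˡ (∙-congʳ (val-step i)) ⟨
      u ∙ (val (step i) ∙ val (codeOf w))           ≈⟨ ∙-congˡ (val-⊕ (step i) (codeOf w)) ⟨
      u ∙ val (step i ⊕ codeOf w)                   ∎

    DistLe⇒code : ∀ {n u v} → DistLe (gen b a₁ a₂) n u v → ∃[ c ] (‖ c ‖ ≤ n × u ∙ val c ≈ v)
    DistLe⇒code {u = u} (w , |w|≤n , end≈v) =
      codeOf w , ℕₚ.≤-trans (‖codeOf‖≤length w) |w|≤n , trans (sym (endpoint-codeOf u w)) end≈v

    code⇒DistLe : ∀ {n u v} c → ‖ c ‖ ≤ n → u ∙ val c ≈ v → DistLe (gen b a₁ a₂) n u v
    code⇒DistLe {n} {u} c ‖c‖≤n u+c≈v =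
      walk c , ≡.subst (_≤ n) (≡.sym (length-walk c)) ‖c‖≤n ,
      trans (endpoint-codeOf u (walk c)) (trans (∙-congˡ (reflexive (≡.cong val (codeOf-walk c)))) u+c≈v)

    val-⊕⊖ : ∀ c d → val (c ⊕ ⊖ d) ≈ val c ∙ val d ⁻¹
    val-⊕⊖ c d = trans (val-⊕ c (⊖ d)) (∙-congˡ (val-⊖ d))

module Counting where
  open TaxicabNorm
  open Codes
  open import Data.Bool using (true; false)
  open import Data.Empty using (⊥-elim)
  open import Data.Fin as Fin using (Fin; suc; toℕ; fromℕ<)
  open import Data.Fin.Patterns using (0F)
  import Data.Fin.Properties as Finₚ
  open import Data.Integer using (ℤ; +_; -[1+_]; ∣_∣; _+_; _-_; -_; _*_)
  import Data.Integer.Properties as ℤₚ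
  open import Data.Nat as ℕ using (ℕ; zero; suc; _≤_; _<_; s≤s)
  import Data.Nat.Properties as ℕₚ
  open import Data.Product using (∃-syntax; _×_; _,_; uncurry)
  open import Data.Sum using (_⊎_; inj₁; inj₂)
  open import Data.Sum.Function.Propositional using (_⊎-↔_)
  open import Function using (_↔_; Inverse; _∘_)
  open import Function.Properties.Inverse using (↔-trans)
  open import Relation.Binary.PropositionalEquality using (_≡_; _≢_; refl; sym; trans; cong; cong₂; module ≡-Reasoning)
  import Data.Integer.Tactic.RingSolver as ℤ-Ring
  import Data.Nat.Tactic.RingSolver as ℕ-Ring

  halve : ∀ n → ∃[ h ] (n ≡ 2 ℕ.* h ⊎ n ≡ suc (2 ℕ.* h))
  halve zero    = 0 , inj₁ refl
  halve (suc n) with halve n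
  ... | h , inj₁ refl = h , inj₂ refl
  ... | h , inj₂ refl = suc h , inj₁ (cong suc (sym (ℕₚ.+-suc h (h ℕ.+ 0))))

  shift-nonneg : ∀ z n → ∣ z ∣ ≤ n → ∃[ s ] (z + + n ≡ + s × s ≤ 2 ℕ.* n)
  shift-nonneg (+ p)    n p≤n = p ℕ.+ n , refl , ℕₚ.+-mono-≤ p≤n (ℕₚ.m≤m+n n 0)
  shift-nonneg -[1+ p ] n p<n = n ℕ.∸ suc p , ℤₚ.⊖-≥ p<n ,
    ℕₚ.≤-trans (ℕₚ.m∸n≤m n (suc p)) (ℕₚ.m≤m+n n (n ℕ.+ 0))

  Square : ℕ → Set
  Square r = Fin r × Fin r

  DiamondIndex : ℕ → Set
  DiamondIndex r = Square (suc r) ⊎ Square r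

  -- In the rotated coordinates (x + y, x - y) the ℓ₁-ball of radius r is the set of pairs of
  -- equal parity in [-r, r]²: a square of even pairs and a square of odd pairs.
  diamond : (r : ℕ) → DiamondIndex r → ℤ × ℤ
  diamond r (inj₁ (i , j)) = + toℕ i + + toℕ j - + r         , + toℕ i - + toℕ j
  diamond r (inj₂ (i , j)) = + toℕ i + + toℕ j + + 1 - + r   , + toℕ i - + toℕ j

  private
    even-part : ∀ i {z} → z ≡ + (2 ℕ.* i) → z ≡ + 2 * + i + + 0
    even-part i z≡ = trans z≡ (trans (ℤₚ.pos-* 2 i) (sym (ℤₚ.+-identityʳ _)))

    odd-part : ∀ i {z} → z ≡ + suc (2 ℕ.* i) → z ≡ + 2 * + i + + 1
    odd-part i z≡ = trans z≡ (trans (cong +_ (ℕₚ.+-comm 1 (2 ℕ.* i))) (cong (_+ + 1) (ℤₚ.pos-* 2 i)))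

    even+odd : ∀ i j → 2 ℕ.* i ℕ.+ suc (2 ℕ.* j) ≡ suc (2 ℕ.* (i ℕ.+ j))
    even+odd = ℕ-Ring.solve-∀

    odd+even : ∀ i j → suc (2 ℕ.* i) ℕ.+ 2 ℕ.* j ≡ suc (2 ℕ.* (i ℕ.+ j))
    odd+even = ℕ-Ring.solve-∀

  rotate-back : ∀ x y r u v e → x + y + r ≡ + 2 * u + e → x - y + r ≡ + 2 * v + e →
                u + v + e - r ≡ x × u - v ≡ y
  rotate-back x y r u v e x+y+r≡2u+e x-y+r≡2v+e = ℤₚ.*-cancelˡ-≡ (+ 2) _ _ (begin
      + 2 * (u + v + e - r)                           ≡⟨ ring₁ u v e r ⟩
      (+ 2 * u + e) + (+ 2 * v + e) - (r + r)         ≡⟨ cong₂ (λ a b → a + b - (r + r)) x+y+r≡2u+e x-y+r≡2v+e ⟨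
      x + y + r + (x - y + r) - (r + r)               ≡⟨ ring₂ x y r ⟩
      + 2 * x                                         ∎)
    , ℤₚ.*-cancelˡ-≡ (+ 2) _ _ (begin
      + 2 * (u - v)                                   ≡⟨ ring₃ u v e ⟩
      (+ 2 * u + e) - (+ 2 * v + e)                   ≡⟨ cong₂ _-_ x+y+r≡2u+e x-y+r≡2v+e ⟨
      x + y + r - (x - y + r)                         ≡⟨ ring₄ x y r ⟩
      + 2 * y                                         ∎)
    where
    open ≡-Reasoning
    ring₁ : ∀ u v e r → + 2 * (u + v + e - r) ≡ (+ 2 * u + e) + (+ 2 * v + e) - (r + r)
    ring₁ = ℤ-Ring.solve-∀
    ring₂ : ∀ x y r → x + y + r + (x - y + r) - (r + r) ≡ + 2 * x
    ring₂ = ℤ-Ring.solve-∀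
    ring₃ : ∀ u v e → + 2 * (u - v) ≡ (+ 2 * u + e) - (+ 2 * v + e)
    ring₃ = ℤ-Ring.solve-∀
    ring₄ : ∀ x y r → x + y + r - (x - y + r) ≡ + 2 * y
    ring₄ = ℤ-Ring.solve-∀

  rotated-sum-even : ∀ x y r s d → ∣ x ∣ ≤ r → x + y + + r ≡ + s → x - y + + r ≡ + d →
                     ∃[ t ] s ℕ.+ d ≡ 2 ℕ.* t
  rotated-sum-even x y r s d ∣x∣≤r x+y+r≡s x-y+r≡d
    with t , x+r≡t , _ ← shift-nonneg x r ∣x∣≤r
    = t , ℤₚ.+-injective (begin
      + s + + d                       ≡⟨ cong₂ _+_ x+y+r≡s x-y+r≡d ⟨
      x + y + + r + (x - y + + r)     ≡⟨ regroup x y (+ r) ⟩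
      (x + + r) + (x + + r)           ≡⟨ cong₂ _+_ x+r≡t x+r≡t ⟩
      + (t ℕ.+ t)                     ≡⟨ cong (λ n → + (t ℕ.+ n)) (ℕₚ.+-identityʳ t) ⟨
      + (2 ℕ.* t)                     ∎)
    where
    open ≡-Reasoning
    regroup : ∀ x y r → x + y + r + (x - y + r) ≡ (x + r) + (x + r)
    regroup = ℤ-Ring.solve-∀

  diamond-surjective : ∀ r x y → ‖ x , y ‖₁ ≤ r → ∃[ ι ] (diamond r ι ≡ (x , y))
  diamond-surjective r x y ‖x‖≤r
    with s , x+y+r≡s , s≤2r ← shift-nonneg (x + y) r (ℕₚ.≤-trans (ℤₚ.∣i+j∣≤∣i∣+∣j∣ x y) ‖x‖≤r)
       | d , x-y+r≡d , d≤2r ← shift-nonneg (x - y) r (ℕₚ.≤-trans (ℤₚ.∣i-j∣≤∣i∣+∣j∣ x y) ‖x‖≤r)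
    with t , s+d≡2t ← rotated-sum-even x y r s d (ℕₚ.≤-trans (ℕₚ.m≤m+n ∣ x ∣ ∣ y ∣) ‖x‖≤r) x+y+r≡s x-y+r≡d
    with halve s | halve d
  ... | i , inj₁ refl | j , inj₁ refl
    with x≡ , y≡ ← rotate-back x y (+ r) (+ i) (+ j) (+ 0) (even-part i x+y+r≡s) (even-part j x-y+r≡d)
    = inj₁ (fromℕ< i≤r , fromℕ< j≤r) ,
      cong₂ _,_ (trans (cong₂ (λ a b → + a + + b - + r) (Finₚ.toℕ-fromℕ< i≤r) (Finₚ.toℕ-fromℕ< j≤r))
                       (trans (cong (_- + r) (sym (ℤₚ.+-identityʳ (+ i + + j)))) x≡))
                (trans (cong₂ (λ a b → + a - + b) (Finₚ.toℕ-fromℕ< i≤r) (Finₚ.toℕ-fromℕ< j≤r)) y≡)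
    where
    i≤r : i < suc r
    i≤r = s≤s (ℕₚ.*-cancelˡ-≤ 2 s≤2r)
    j≤r : j < suc r
    j≤r = s≤s (ℕₚ.*-cancelˡ-≤ 2 d≤2r)
  ... | i , inj₂ refl | j , inj₂ refl
    with x≡ , y≡ ← rotate-back x y (+ r) (+ i) (+ j) (+ 1) (odd-part i x+y+r≡s) (odd-part j x-y+r≡d)
    = inj₂ (fromℕ< i<r , fromℕ< j<r) ,
      cong₂ _,_ (trans (cong₂ (λ a b → + a + + b + + 1 - + r) (Finₚ.toℕ-fromℕ< i<r) (Finₚ.toℕ-fromℕ< j<r)) x≡)
                (trans (cong₂ (λ a b → + a - + b) (Finₚ.toℕ-fromℕ< i<r) (Finₚ.toℕ-fromℕ< j<r)) y≡)
    where
    i<r : i < r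
    i<r = ℕₚ.*-cancelˡ-< 2 i r s≤2r
    j<r : j < r
    j<r = ℕₚ.*-cancelˡ-< 2 j r d≤2r
  ... | i , inj₁ refl | j , inj₂ refl =
    ⊥-elim (ℕₚ.even≢odd t (i ℕ.+ j) (trans (sym s+d≡2t) (even+odd i j)))
  ... | i , inj₂ refl | j , inj₁ refl =
    ⊥-elim (ℕₚ.even≢odd t (i ℕ.+ j) (trans (sym s+d≡2t) (odd+even i j)))

  diamondSize : ℕ → ℕ
  diamondSize r = suc r ℕ.* suc r ℕ.+ r ℕ.* r

  Fin↔diamondIndex : ∀ r → Fin (diamondSize r) ↔ DiamondIndex r
  Fin↔diamondIndex r = ↔-trans Finₚ.+↔⊎ (Finₚ.*↔× ⊎-↔ Finₚ.*↔×)

  BallIndex : ℕ → Set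
  BallIndex r = DiamondIndex (suc r) ⊎ DiamondIndex r

  ballSize : ℕ → ℕ
  ballSize r = diamondSize (suc r) ℕ.+ diamondSize r

  Fin↔BallIndex : ∀ r → Fin (ballSize r) ↔ BallIndex r
  Fin↔BallIndex r = ↔-trans Finₚ.+↔⊎ (Fin↔diamondIndex (suc r) ⊎-↔ Fin↔diamondIndex r)

  ball : (r : ℕ) → BallIndex r → Code
  ball r (inj₁ ι) = uncurry (code false) (diamond (suc r) ι)
  ball r (inj₂ ι) = uncurry (code true) (diamond r ι)

  ball-surjective : ∀ r c → ‖ c ‖ ≤ suc r → ∃[ β ] (ball r β ≡ c)
  ball-surjective r (code false x y) ‖c‖≤1+r
    with ι , ι↦xy ← diamond-surjective (suc r) x y ‖c‖≤1+r = inj₁ ι , cong (uncurry (code false)) ι↦xy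
  ball-surjective r (code true x y) (s≤s ‖c‖≤r)
    with ι , ι↦xy ← diamond-surjective r x y ‖c‖≤r = inj₂ ι , cong (uncurry (code true)) ι↦xy

  ballCode : ∀ m → Fin (ballSize (suc m)) → Code
  ballCode m = ball (suc m) ∘ Inverse.to (Fin↔BallIndex (suc m))

  ballCode-surjective : ∀ m c → ‖ c ‖ ≤ 2 ℕ.+ m → ∃[ i ] (ballCode m i ≡ c)
  ballCode-surjective m c ‖c‖≤k with β , β↦c ← ball-surjective (suc m) c ‖c‖≤k =
    Inverse.from (Fin↔BallIndex (suc m)) β ,
    trans (cong (ball (suc m)) (Inverse.strictlyInverseˡ (Fin↔BallIndex (suc m)) β)) β↦c

  ballSize≡ : ∀ m → ballSize (suc m) ≡ 2 ℕ.+ 4 ℕ.* (2 ℕ.+ m) ℕ.* (2 ℕ.+ m)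
  ballSize≡ m = expand m
    where
    expand : ∀ m → ((3 ℕ.+ m) ℕ.* (3 ℕ.+ m) ℕ.+ (2 ℕ.+ m) ℕ.* (2 ℕ.+ m)) ℕ.+
                   ((2 ℕ.+ m) ℕ.* (2 ℕ.+ m) ℕ.+ (1 ℕ.+ m) ℕ.* (1 ℕ.+ m))
                   ≡ 2 ℕ.+ 4 ℕ.* (2 ℕ.+ m) ℕ.* (2 ℕ.+ m)
    expand = ℕ-Ring.solve-∀

  fixed-point-free-involution⇒even : ∀ n (τ : Fin n → Fin n) → (∀ i → τ (τ i) ≡ i) → (∀ i → τ i ≢ i) →
    ∃[ h ] n ≡ 2 ℕ.* h
  fixed-point-free-involution⇒even zero          τ τ²≡id τ≢id = 0 , refl
  fixed-point-free-involution⇒even (suc zero)    τ τ²≡id τ≢id with τ 0F in τ0≡0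
  ... | 0F = ⊥-elim (τ≢id 0F τ0≡0)
  fixed-point-free-involution⇒even (suc (suc n)) τ τ²≡id τ≢id with τ 0F in τ0≡j
  ... | 0F    = ⊥-elim (τ≢id 0F τ0≡j)
  ... | suc j = add-pair (fixed-point-free-involution⇒even n τ′ τ′²≡id τ′≢id)
    where
    add-pair : ∃[ h ] n ≡ 2 ℕ.* h → ∃[ h ] suc (suc n) ≡ 2 ℕ.* h
    add-pair (h , n≡2h) = suc h , cong suc (trans (cong suc n≡2h) (sym (ℕₚ.+-suc h (h ℕ.+ 0))))

    -- the points of Fin (2 + n) other than 0 and τ 0
    rest : Fin n → Fin (suc (suc n))
    rest i = suc (Fin.punchIn j i)

    rest-injective : ∀ {i i′} → rest i ≡ rest i′ → i ≡ i′
    rest-injective eq = Finₚ.punchIn-injective j _ _ (Finₚ.suc-injective eq)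

    τ-rest≢0 : ∀ i → τ (rest i) ≢ 0F
    τ-rest≢0 i τi≡0 = Finₚ.punchInᵢ≢i j i (Finₚ.suc-injective (begin
      rest i           ≡⟨ τ²≡id (rest i) ⟨
      τ (τ (rest i))   ≡⟨ cong τ τi≡0 ⟩
      τ 0F             ≡⟨ τ0≡j ⟩
      suc j            ∎))
      where open ≡-Reasoning

    τ-rest≢τ0 : ∀ i → τ (rest i) ≢ suc j
    τ-rest≢τ0 i τi≡j = 0≢rest (begin
      0F               ≡⟨ τ²≡id 0F ⟨
      τ (τ 0F)         ≡⟨ cong τ τ0≡j ⟩
      τ (suc j)        ≡⟨ cong τ τi≡j ⟨
      τ (τ (rest i))   ≡⟨ τ²≡id (rest i) ⟩
      rest i           ∎)
      where
      open ≡-Reasoning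
      0≢rest : 0F ≢ rest i
      0≢rest ()

    τ-rest-pred : Fin n → Fin (suc n)
    τ-rest-pred i = Fin.punchOut (τ-rest≢0 i ∘ sym)

    suc-τ-rest-pred : ∀ i → suc (τ-rest-pred i) ≡ τ (rest i)
    suc-τ-rest-pred i = Finₚ.punchIn-punchOut (τ-rest≢0 i ∘ sym)

    τ′ : Fin n → Fin n
    τ′ i = Fin.punchOut (λ j≡pred → τ-rest≢τ0 i (trans (sym (suc-τ-rest-pred i)) (cong suc (sym j≡pred))))

    rest-τ′ : ∀ i → rest (τ′ i) ≡ τ (rest i)
    rest-τ′ i = trans (cong suc (Finₚ.punchIn-punchOut _)) (suc-τ-rest-pred i)

    τ′²≡id : ∀ i → τ′ (τ′ i) ≡ i
    τ′²≡id i = rest-injective (trans (rest-τ′ (τ′ i)) (trans (cong τ (rest-τ′ i)) (τ²≡id (rest i))))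

    τ′≢id : ∀ i → τ′ i ≢ i
    τ′≢id i τ′i≡i = τ≢id (rest i) (trans (sym (rest-τ′ i)) (cong rest τ′i≡i))

module UpperBound where
  open Codes
  open PerfectCodes
  open GroupEvaluation
  open Counting
  open import Defs
  open import Data.Empty using (⊥-elim)
  open import Data.Fin as Fin using (Fin)
  import Data.Fin.Properties as Finₚ
  open import Data.Nat as ℕ using (ℕ; suc; _≤_; _<_; s≤s)
  import Data.Nat.Properties as ℕₚ
  open import Data.Product using (∃-syntax; ∃₂; _×_; _,_; proj₁; proj₂)
  open import Function using (_∘_)
  open import Relation.Nullary using (¬_; Dec; yes; no)
  open import Relation.Nullary.Decidable using (map′; ¬?; _×-dec_)
  open import Relation.Binary.PropositionalEquality as ≡ using (_≡_; _≢_)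
  import Data.Nat.Tactic.RingSolver as ℕ-Ring

  module FiniteGroupCounting {c ℓ} (Γ : FiniteAbelianGroup c ℓ) where
    open FiniteAbelianGroup Γ
    open import Algebra.Properties.AbelianGroup abGroup using (identityʳ-unique)
    open import Relation.Binary.Reasoning.Setoid setoid

    _≈?_ : ∀ x y → Dec (x ≈ y)
    x ≈? y with i , i↦x ← enum-surj x | j , j↦y ← enum-surj y =
      map′ (λ { ≡.refl → trans (sym i↦x) j↦y }) (λ x≈y → enum-inj i j (trans i↦x (trans x≈y (sym j↦y)))) (i Fin.≟ j)

    -- Send each element to a preimage under f, chosen to avoid i; then punch i out.
    order<-of-non-injective-surjection : ∀ {M} (f : Fin M → Carrier) → (∀ g → ∃[ i ] f i ≈ g) →
      ∀ {i j} → i ≢ j → f i ≈ f j → order < M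
    order<-of-non-injective-surjection {suc M} f f-surjective {i} {j} i≢j fi≈fj =
      s≤s (Finₚ.injective⇒≤ compress-injective)
      where
      avoid-i : Fin (suc M) → Fin (suc M)
      avoid-i x with x Fin.≟ i
      ... | yes _ = j
      ... | no  _ = x

      avoid-i≢i : ∀ x → avoid-i x ≢ i
      avoid-i≢i x with x Fin.≟ i
      ... | yes _   = i≢j ∘ ≡.sym
      ... | no  x≢i = x≢i

      f-avoid-i : ∀ x → f (avoid-i x) ≈ f x
      f-avoid-i x with x Fin.≟ i
      ... | yes ≡.refl = sym fi≈fj
      ... | no  _    = refl

      pick : Fin order → Fin (suc M)
      pick n = avoid-i (proj₁ (f-surjective (enum n)))

      f-pick : ∀ n → f (pick n) ≈ enum n
      f-pick n = trans (f-avoid-i _) (proj₂ (f-surjective (enum n)))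

      i≢pick : ∀ n → i ≢ pick n
      i≢pick n = avoid-i≢i (proj₁ (f-surjective (enum n))) ∘ ≡.sym

      compress : Fin order → Fin M
      compress n = Fin.punchOut (i≢pick n)

      compress-injective : ∀ {n n′} → compress n ≡ compress n′ → n ≡ n′
      compress-injective {n} {n′} eq = enum-inj n n′ (begin
        enum n       ≈⟨ f-pick n ⟨
        f (pick n)   ≡⟨ ≡.cong f (Finₚ.punchOut-injective (i≢pick n) (i≢pick n′) eq) ⟩
        f (pick n′)  ≈⟨ f-pick n′ ⟩
        enum n′      ∎)

    order-even : ∀ {b} → ¬ b ≈ ε → b ∙ b ≈ ε → ∃[ h ] order ≡ 2 ℕ.* h
    order-even {b} b≉ε b∙b≈ε = fixed-point-free-involution⇒even order τ τ²≡id τ≢id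
      where
      τ : Fin order → Fin order
      τ n = proj₁ (enum-surj (enum n ∙ b))

      enum-τ : ∀ n → enum (τ n) ≈ enum n ∙ b
      enum-τ n = proj₂ (enum-surj (enum n ∙ b))

      τ²≡id : ∀ n → τ (τ n) ≡ n
      τ²≡id n = enum-inj _ _ (begin
        enum (τ (τ n))   ≈⟨ enum-τ (τ n) ⟩
        enum (τ n) ∙ b   ≈⟨ ∙-congʳ (enum-τ n) ⟩
        enum n ∙ b ∙ b   ≈⟨ assoc _ _ _ ⟩
        enum n ∙ (b ∙ b) ≈⟨ ∙-congˡ b∙b≈ε ⟩
        enum n ∙ ε       ≈⟨ identityʳ _ ⟩
        enum n           ∎)

      τ≢id : ∀ n → τ n ≢ n
      τ≢id n τn≡n = b≉ε (identityʳ-unique (enum n) b (trans (sym (enum-τ n)) (reflexive (≡.cong enum τn≡n))))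

  private
    even<2+2x⇒≤2x : ∀ {n} h x → n ≡ 2 ℕ.* h → n < 2 ℕ.+ 2 ℕ.* x → n ≤ 2 ℕ.* x
    even<2+2x⇒≤2x h x ≡.refl n<2+2x =
      ℕₚ.*-monoʳ-≤ 2 (ℕₚ.≤-pred (ℕₚ.*-cancelˡ-< 2 h (suc x) (ℕₚ.≤-trans n<2+2x (ℕₚ.≤-reflexive (2+2x x)))))
      where
      2+2x : ∀ x → 2 ℕ.+ 2 ℕ.* x ≡ 2 ℕ.* suc x
      2+2x = ℕ-Ring.solve-∀

  module _ {c ℓ} (Γ : FiniteAbelianGroup c ℓ) (m : ℕ) {b a₁ a₂ : FiniteAbelianGroup.Carrier Γ}
           (b-involution : Cayley.IsInvolution (FiniteAbelianGroup.abGroup Γ) b)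
           (dist≤k : ∀ u v → Cayley.DistLe (FiniteAbelianGroup.abGroup Γ)
                                           (Cayley.gen (FiniteAbelianGroup.abGroup Γ) b a₁ a₂) (2 ℕ.+ m) u v)
           where
    open FiniteAbelianGroup Γ
    open import Algebra.Properties.AbelianGroup abGroup using (ε⁻¹≈ε; x∙y⁻¹≈ε⇒x≈y; x≈y⇒x∙y⁻¹≈ε)
    open FiniteGroupCounting Γ
    open Evaluation abGroup b a₁ a₂ (proj₂ b-involution)

    private
      k : ℕ
      k = 2 ℕ.+ m

    short-code : ∀ g → ∃[ c ] (‖ c ‖ ≤ k × val c ≈ g)
    short-code g with c , ‖c‖≤k , ε∙c≈g ← DistLe⇒code (dist≤k ε g) = c , ‖c‖≤k , trans (sym (identityˡ _)) ε∙c≈g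

    ballCode-val-surjective : ∀ g → ∃[ i ] val (ballCode m i) ≈ g
    ballCode-val-surjective g with c , ‖c‖≤k , c↦g ← short-code g
                              with i , ≡.refl ← ballCode-surjective m c ‖c‖≤k = i , c↦g

    Collision : Set ℓ
    Collision = ∃₂ λ i j → i ≢ j × val (ballCode m i) ≈ val (ballCode m j)

    collision? : Dec Collision
    collision? = Finₚ.any? λ i → Finₚ.any? λ j → ¬? (i Fin.≟ j) ×-dec (val (ballCode m i) ≈? val (ballCode m j))

    Vanishes : Code → Set ℓ
    Vanishes c = val c ≈ ε

    perfect-without-collision : ¬ Collision → PerfectCode k Vanishes
    perfect-without-collision no-collision = record
      { K-⊕      = λ {c} {d} c↦ε d↦ε → trans (val-⊕ c d) (trans (∙-cong c↦ε d↦ε) (identityˡ ε))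
      ; K-⊖      = λ {c} c↦ε → trans (val-⊖ c) (trans (⁻¹-cong c↦ε) ε⁻¹≈ε)
      ; K-unique = unique
      ; K-cover  = cover
      }
      where
      unique : ∀ {c d} → ‖ c ‖ ≤ k → ‖ d ‖ ≤ k → Vanishes (c ⊕ ⊖ d) → c ≡ d
      unique {c} {d} ‖c‖≤k ‖d‖≤k c-d↦ε
        with i , ≡.refl ← ballCode-surjective m c ‖c‖≤k | j , ≡.refl ← ballCode-surjective m d ‖d‖≤k
        with i Fin.≟ j
      ... | yes ≡.refl = ≡.refl
      ... | no  i≢j    = ⊥-elim (no-collision (i , j , i≢j , x∙y⁻¹≈ε⇒x≈y _ _ (trans (sym (val-⊕⊖ c d)) c-d↦ε)))

      cover : ∀ t → ∃[ c ] (‖ c ‖ ≤ k × Vanishes (c ⊕ ⊖ t))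
      cover t with c , ‖c‖≤k , c↦t ← short-code (val t) = c , ‖c‖≤k , trans (val-⊕⊖ c t) (x≈y⇒x∙y⁻¹≈ε c↦t)

    order≤4k²-with-collision : Collision → order ≤ 4 ℕ.* k ℕ.* k
    order≤4k²-with-collision (i , j , i≢j , same) =
      ≡.subst (order ≤_) (≡.sym (4k²≡2[2k²] k))
        (even<2+2x⇒≤2x (proj₁ order-is-even) (2 ℕ.* k ℕ.* k) (proj₂ order-is-even) order<2+4k²)
      where
      4k²≡2[2k²] : ∀ k → 4 ℕ.* k ℕ.* k ≡ 2 ℕ.* (2 ℕ.* k ℕ.* k)
      4k²≡2[2k²] = ℕ-Ring.solve-∀
      order-is-even : ∃[ h ] order ≡ 2 ℕ.* h
      order-is-even = order-even (proj₁ b-involution) (proj₂ b-involution)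
      order<2+4k² : order < 2 ℕ.+ 2 ℕ.* (2 ℕ.* k ℕ.* k)
      order<2+4k² = ≡.subst (order <_) (≡.trans (ballSize≡ m) (≡.cong (2 ℕ.+_) (4k²≡2[2k²] k)))
        (order<-of-non-injective-surjection (val ∘ ballCode m) ballCode-val-surjective i≢j same)

    order≤4k² : order ≤ 4 ℕ.* k ℕ.* k
    order≤4k² with collision?
    ... | yes collision    = order≤4k²-with-collision collision
    ... | no  no-collision = ⊥-elim (no-perfect-code (perfect-without-collision no-collision))

module Extremal where
  open TaxicabNorm
  open Codes
  open GroupEvaluation
  open import Defs
  open import Algebra.Bundles using (AbelianGroup)
  open import Data.Bool using (true; false)
  open import Data.Empty using (⊥; ⊥-elim)
  open import Data.Fin as Fin using (Fin)
  open import Data.Fin.Patterns using (0F; 1F; 2F; 3F; 4F)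
  open import Data.Integer as ℤ using (ℤ; +_; -[1+_]; ∣_∣; _+_; _-_; -_; _*_)
  import Data.Integer.Properties as ℤₚ
  open import Data.Nat as ℕ using (ℕ; zero; suc; _≤_; _<_; _∸_; z≤n; s≤s)
  import Data.Nat.Properties as ℕₚ
  open import Data.Product using (∃-syntax; _×_; _,_; proj₁; proj₂)
  open import Data.Sum using (_⊎_; inj₁; inj₂)
  open import Relation.Nullary using (¬_; Dec; yes; no)
  open import Function using (_∘_)
  open import Relation.Binary.PropositionalEquality as ≡ using (_≡_; _≢_; refl; cong; cong₂; module ≡-Reasoning)
  import Data.Integer.Tactic.RingSolver as ℤ-Ring
  import Data.Nat.Tactic.RingSolver as ℕ-Ring
  import Data.Nat.DivMod as DivMod
  import Data.Integer.DivMod as ℤ-DivMod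
  import Relation.Binary.Reasoning.Setoid

  ≡[mod]-injective : ∀ {N x y} → ∣ x - y ∣ < N → x ≡[mod N ] y → x ≡ y
  ≡[mod]-injective {N} {x} {y} ∣x-y∣<N (q , x≡y+qN) = multiple-of-N q (≡.trans (cong (_- y) x≡y+qN) (cancel y q (+ N)))
    where
    cancel : ∀ y q n → y + q * n - y ≡ q * n
    cancel = ℤ-Ring.solve-∀
    too-far : ∀ n → ∣ x - y ∣ ≡ suc n ℕ.* N → ⊥
    too-far n ∣x-y∣≡ = ℕₚ.<-irrefl refl (ℕₚ.≤-<-trans (ℕₚ.≤-trans (ℕₚ.m≤n*m N (suc n)) (ℕₚ.≤-reflexive (≡.sym ∣x-y∣≡))) ∣x-y∣<N)
    multiple-of-N : ∀ q → x - y ≡ q * + N → x ≡ y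
    multiple-of-N (+ zero)  x-y≡0  = ℤₚ.i-j≡0⇒i≡j x y x-y≡0
    multiple-of-N (+ suc n) x-y≡qN = ⊥-elim (too-far n (≡.trans (cong ∣_∣ x-y≡qN) (ℤₚ.∣i*j∣≡∣i∣*∣j∣ (+ suc n) (+ N))))
    multiple-of-N -[1+ n ]  x-y≡qN = ⊥-elim (too-far n (≡.trans (cong ∣_∣ x-y≡qN) (ℤₚ.∣i*j∣≡∣i∣*∣j∣ -[1+ n ] (+ N))))

  ≡[mod]-residue : ∀ N .{{_ : ℕ.NonZero N}} t → t ≡[mod N ] (+ (t ℤ.%ℕ N))
  ≡[mod]-residue N t = t ℤ./ℕ N , ℤ-DivMod.a≡a%ℕn+[a/ℕn]*n t N

  ≡[mod]-complement : ∀ {N r} → r ≤ N → (- + (N ∸ r)) ≡[mod N ] (+ r)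
  ≡[mod]-complement {N} {r} r≤N = - + 1 , ≡.trans (cong -_ N∸r≡N-r) (negate (+ N) (+ r))
    where
    N∸r≡N-r : + (N ∸ r) ≡ + N - + r
    N∸r≡N-r = ≡.sym (≡.trans (ℤₚ.[+m]-[+n]≡m⊖n N r) (ℤₚ.⊖-≥ r≤N))
    negate : ∀ n r → - (n - r) ≡ r + - + 1 * n
    negate = ℤ-Ring.solve-∀

  -- The value of a code in Cay(ℤ_{4k²}, {±1, ±(2k - 1), 2k²}), before reduction modulo 4k².
  codeValue : ℕ → Code → ℤ
  codeValue k (code false x y) = + 0 + (x + y * + (2 ℕ.* k ∸ 1))
  codeValue k (code true  x y) = + (2 ℕ.* k ℕ.* k) + (x + y * + (2 ℕ.* k ∸ 1))

  ShortRepresentation : ℕ → ℤ → Set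
  ShortRepresentation k v = ∃[ c ] (‖ c ‖ ≤ k × codeValue k c ≡ v)

  private
    ≤-shift : ∀ {a b c d} → c ≤ d → a ℕ.+ d ≤ b ℕ.+ c → a ≤ b
    ≤-shift {a} {b} {c} {d} c≤d a+d≤b+c = ℕₚ.+-cancelʳ-≤ d a b (ℕₚ.≤-trans a+d≤b+c (ℕₚ.+-monoʳ-≤ b c≤d))

    ∣-∣≤ : ∀ a b c → a ≤ b ℕ.+ c → b ≤ a ℕ.+ c → ∣ + a - + b ∣ ≤ c
    ∣-∣≤ a b c a≤b+c b≤a+c with ℕₚ.≤-total a b
    ... | inj₁ a≤b = ≡.subst (_≤ c) (≡.sym (≡.trans (cong ∣_∣ (ℤₚ.[+m]-[+n]≡m⊖n a b)) (ℤₚ.∣⊖∣-≤ a≤b)))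
                       (ℕₚ.m≤n+o⇒m∸n≤o b a b≤a+c)
    ... | inj₂ b≤a = ≡.subst (_≤ c) (≡.sym (≡.trans (cong ∣_∣ (ℤₚ.[+m]-[+n]≡m⊖n a b)) (cong ∣_∣ (ℤₚ.⊖-≥ b≤a))))
                       (ℕₚ.m≤n+o⇒m∸n≤o a b a≤b+c)

    ∣a-[a+b]∣ : ∀ a b → ∣ + a - + (a ℕ.+ b) ∣ ≡ b
    ∣a-[a+b]∣ a b = ≡.trans (cong ∣_∣ (ℤₚ.[+m]-[+n]≡m⊖n a (a ℕ.+ b)))
                   (≡.trans (ℤₚ.∣⊖∣-≤ (ℕₚ.m≤m+n a b)) (ℕₚ.m+n∸m≡n a b))

    pos-2k∸1 : ∀ k → + (2 ℕ.* suc k ∸ 1) ≡ + 2 * + suc k - + 1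
    pos-2k∸1 k = ≡.trans (cong +_ (expand k)) (≡.trans (cong (_+_ (+ 1)) (ℤₚ.pos-* 2 k)) (expand′ (+ k)))
      where
      expand : ∀ k → k ℕ.+ suc (k ℕ.+ 0) ≡ 1 ℕ.+ 2 ℕ.* k
      expand = ℕ-Ring.solve-∀
      expand′ : ∀ K → + 1 + + 2 * K ≡ + 2 * (+ 1 + K) - + 1
      expand′ = ℤ-Ring.solve-∀

    pos-2kk : ∀ k → + (2 ℕ.* k ℕ.* k) ≡ + 2 * + k * + k
    pos-2kk k = ≡.trans (ℤₚ.pos-* (2 ℕ.* k) k) (cong (_* + k) (ℤₚ.pos-* 2 k))

  -- In the next four lemmas r = R + 2kQ with R < 2k and k = 1 + Q + t.  The representing code has
  -- y = Q or y = Q + 1, shifted by -k when it contains b, and x is then forced by the value.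
  short-code-y≡Q : ∀ Q R t → R ℕ.+ 2 ℕ.* Q ≤ suc (Q ℕ.+ t) →
    ShortRepresentation (suc (Q ℕ.+ t)) (+ R + + Q * (+ 2 * + suc (Q ℕ.+ t)))
  short-code-y≡Q Q R t R+2Q≤k =
    code false (+ (Q ℕ.+ R)) (+ Q) , ≡.subst (_≤ suc (Q ℕ.+ t)) (norm Q R) R+2Q≤k ,
    ≡.trans (cong (λ a → + 0 + (+ Q + + R + + Q * a)) (pos-2k∸1 (Q ℕ.+ t))) (value (+ Q) (+ R) (+ suc (Q ℕ.+ t)))
    where
    norm : ∀ Q R → R ℕ.+ 2 ℕ.* Q ≡ Q ℕ.+ R ℕ.+ Q
    norm = ℕ-Ring.solve-∀
    value : ∀ Q R K → + 0 + (Q + R + Q * (+ 2 * K - + 1)) ≡ R + Q * (+ 2 * K)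
    value = ℤ-Ring.solve-∀

  short-code-b,y≡Q-k : ∀ Q R t → R < suc (Q ℕ.+ t) → suc (Q ℕ.+ t) < R ℕ.+ 2 ℕ.* Q →
    ShortRepresentation (suc (Q ℕ.+ t)) (+ R + + Q * (+ 2 * + suc (Q ℕ.+ t)))
  short-code-b,y≡Q-k zero     R t R<k k<R+0 = ⊥-elim (ℕₚ.<-asym R<k (≡.subst (_ <_) (ℕₚ.+-identityʳ R) k<R+0))
  short-code-b,y≡Q-k (suc Q′) R t R<k k<R+2Q =
    code true (+ (suc Q′ ℕ.+ R) - K) (+ suc Q′ - K) ,
    s≤s (ℕₚ.≤-trans (ℕₚ.+-mono-≤ ∣x∣≤Q′ (ℕₚ.≤-reflexive ∣y∣≡1+t)) (ℕₚ.≤-reflexive (ℕₚ.+-suc Q′ t))) ,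
    ≡.trans (cong₂ (λ b a → b + (+ suc Q′ + + R - K + (+ suc Q′ - K) * a))
                   (pos-2kk (suc (suc Q′ ℕ.+ t))) (pos-2k∸1 (suc Q′ ℕ.+ t)))
            (value (+ Q′) (+ R) K)
    where
    K : ℤ
    K = + suc (suc Q′ ℕ.+ t)
    ∣y∣≡1+t : ∣ + suc Q′ - K ∣ ≡ suc t
    ∣y∣≡1+t = ≡.trans (cong (λ n → ∣ + suc Q′ - + n ∣) (≡.sym (ℕₚ.+-suc (suc Q′) t))) (∣a-[a+b]∣ (suc Q′) (suc t))
    ∣x∣≤Q′ : ∣ + (suc Q′ ℕ.+ R) - K ∣ ≤ Q′
    ∣x∣≤Q′ = ∣-∣≤ (suc Q′ ℕ.+ R) (suc (suc Q′ ℕ.+ t)) Q′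
               (≤-shift R<k (ℕₚ.≤-reflexive (shift₁ Q′ R t))) (≤-shift k<R+2Q (ℕₚ.≤-reflexive (shift₂ Q′ R t)))
      where
      shift₁ : ∀ Q′ R t → suc Q′ ℕ.+ R ℕ.+ suc (suc Q′ ℕ.+ t) ≡ suc (suc Q′ ℕ.+ t) ℕ.+ Q′ ℕ.+ suc R
      shift₁ = ℕ-Ring.solve-∀
      shift₂ : ∀ Q′ R t → suc (suc Q′ ℕ.+ t) ℕ.+ (R ℕ.+ 2 ℕ.* suc Q′) ≡ suc Q′ ℕ.+ R ℕ.+ Q′ ℕ.+ suc (suc (suc Q′ ℕ.+ t))
      shift₂ = ℕ-Ring.solve-∀
    value : ∀ Q′ R K → + 2 * K * K + (+ 1 + Q′ + R - K + (+ 1 + Q′ - K) * (+ 2 * K - + 1)) ≡ R + (+ 1 + Q′) * (+ 2 * K)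
    value = ℤ-Ring.solve-∀

  short-code-y≡Q+1 : ∀ Q R t → suc (Q ℕ.+ t) ≤ R → R ℕ.+ 2 ℕ.* Q ℕ.+ 2 ≤ 3 ℕ.* suc (Q ℕ.+ t) →
    ShortRepresentation (suc (Q ℕ.+ t)) (+ R + + Q * (+ 2 * + suc (Q ℕ.+ t)))
  short-code-y≡Q+1 Q R t k≤R R+2Q+2≤3k =
    code false (+ (suc Q ℕ.+ R) - + (2 ℕ.* k)) (+ suc Q) ,
    ℕₚ.≤-trans (ℕₚ.+-monoˡ-≤ (suc Q) ∣x∣≤t) (ℕₚ.≤-reflexive (ℕₚ.+-comm t (suc Q))) ,
    ≡.trans (cong₂ (λ d a → + 0 + (+ suc Q + + R - d + + suc Q * a)) (ℤₚ.pos-* 2 k) (pos-2k∸1 (Q ℕ.+ t)))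
            (value (+ Q) (+ R) (+ k))
    where
    k : ℕ
    k = suc (Q ℕ.+ t)
    ∣x∣≤t : ∣ + (suc Q ℕ.+ R) - + (2 ℕ.* k) ∣ ≤ t
    ∣x∣≤t = ∣-∣≤ (suc Q ℕ.+ R) (2 ℕ.* k) t (≤-shift R+2Q+2≤3k (ℕₚ.≤-reflexive (shift₁ Q R t)))
                                           (≤-shift k≤R (ℕₚ.≤-reflexive (shift₂ Q R t)))
      where
      shift₁ : ∀ Q R t → suc Q ℕ.+ R ℕ.+ 3 ℕ.* suc (Q ℕ.+ t) ≡ 2 ℕ.* suc (Q ℕ.+ t) ℕ.+ t ℕ.+ (R ℕ.+ 2 ℕ.* Q ℕ.+ 2)
      shift₁ = ℕ-Ring.solve-∀
      shift₂ : ∀ Q R t → 2 ℕ.* suc (Q ℕ.+ t) ℕ.+ R ≡ suc Q ℕ.+ R ℕ.+ t ℕ.+ suc (Q ℕ.+ t)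
      shift₂ = ℕ-Ring.solve-∀
    value : ∀ Q R K → + 0 + (+ 1 + Q + R - + 2 * K + (+ 1 + Q) * (+ 2 * K - + 1)) ≡ R + Q * (+ 2 * K)
    value = ℤ-Ring.solve-∀

  short-code-b,y≡Q+1-k : ∀ Q R t → R < 2 ℕ.* suc (Q ℕ.+ t) → 3 ℕ.* suc (Q ℕ.+ t) < R ℕ.+ 2 ℕ.* Q ℕ.+ 2 →
    ShortRepresentation (suc (Q ℕ.+ t)) (+ R + + Q * (+ 2 * + suc (Q ℕ.+ t)))
  short-code-b,y≡Q+1-k Q R t R<2k 3k<R+2Q+2 =
    code true (+ (suc Q ℕ.+ R) - + (3 ℕ.* k)) (+ suc Q - + k) ,
    s≤s (ℕₚ.+-mono-≤ ∣x∣≤Q (ℕₚ.≤-reflexive (∣a-[a+b]∣ (suc Q) t))) ,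
    ≡.trans (cong₂ (λ b a → b + (+ suc Q + + R - + (3 ℕ.* k) + (+ suc Q - + k) * a)) (pos-2kk k) (pos-2k∸1 (Q ℕ.+ t)))
    (≡.trans (cong (λ d → + 2 * + k * + k + (+ suc Q + + R - d + (+ suc Q - + k) * (+ 2 * + k - + 1))) (ℤₚ.pos-* 3 k))
             (value (+ Q) (+ R) (+ k)))
    where
    k : ℕ
    k = suc (Q ℕ.+ t)
    ∣x∣≤Q : ∣ + (suc Q ℕ.+ R) - + (3 ℕ.* k) ∣ ≤ Q
    ∣x∣≤Q = ∣-∣≤ (suc Q ℕ.+ R) (3 ℕ.* k) Q
              (≤-shift R<2k (ℕₚ.≤-trans (ℕₚ.m≤m+n _ k) (ℕₚ.≤-reflexive (slack Q R t))))
              (≤-shift 3k<R+2Q+2 (ℕₚ.≤-reflexive (shift Q R t)))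
      where
      slack : ∀ Q R t → suc Q ℕ.+ R ℕ.+ 2 ℕ.* suc (Q ℕ.+ t) ℕ.+ suc (Q ℕ.+ t) ≡ 3 ℕ.* suc (Q ℕ.+ t) ℕ.+ Q ℕ.+ suc R
      slack = ℕ-Ring.solve-∀
      shift : ∀ Q R t → 3 ℕ.* suc (Q ℕ.+ t) ℕ.+ (R ℕ.+ 2 ℕ.* Q ℕ.+ 2) ≡ suc Q ℕ.+ R ℕ.+ Q ℕ.+ suc (3 ℕ.* suc (Q ℕ.+ t))
      shift = ℕ-Ring.solve-∀
    value : ∀ Q R K → + 2 * K * K + (+ 1 + Q + R - + 3 * K + (+ 1 + Q - K) * (+ 2 * K - + 1)) ≡ R + Q * (+ 2 * K)
    value = ℤ-Ring.solve-∀

  short-code-for-R+2kQ : ∀ Q R t → R < 2 ℕ.* suc (Q ℕ.+ t) →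
    ShortRepresentation (suc (Q ℕ.+ t)) (+ R + + Q * (+ 2 * + suc (Q ℕ.+ t)))
  short-code-for-R+2kQ Q R t R<2k
    with R ℕ.+ 2 ℕ.* Q ℕ.≤? suc (Q ℕ.+ t) | R ℕ.<? suc (Q ℕ.+ t) | R ℕ.+ 2 ℕ.* Q ℕ.+ 2 ℕ.≤? 3 ℕ.* suc (Q ℕ.+ t)
  ... | yes R+2Q≤k | _       | _              = short-code-y≡Q Q R t R+2Q≤k
  ... | no  R+2Q≰k | yes R<k | _              = short-code-b,y≡Q-k Q R t R<k (ℕₚ.≰⇒> R+2Q≰k)
  ... | no  _      | no  R≮k | yes R+2Q+2≤3k = short-code-y≡Q+1 Q R t (ℕₚ.≮⇒≥ R≮k) R+2Q+2≤3k
  ... | no  _      | no  _   | no  R+2Q+2≰3k = short-code-b,y≡Q+1-k Q R t R<2k (ℕₚ.≰⇒> R+2Q+2≰3k)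

  represent : ∀ k r → r ≤ 2 ℕ.* k ℕ.* k → ShortRepresentation k (+ r)
  represent zero      .0 z≤n    = code false (+ 0) (+ 0) , z≤n , refl
  represent k@(suc _) r  r≤2k² = by-quotient (ℕₚ.m≤n⇒m<n∨m≡n Q≤k)
    where
    Q R : ℕ
    Q = r ℕ./ (2 ℕ.* k)
    R = r ℕ.% (2 ℕ.* k)

    r≡R+Q[2k] : r ≡ R ℕ.+ Q ℕ.* (2 ℕ.* k)
    r≡R+Q[2k] = DivMod.m≡m%n+[m/n]*n r (2 ℕ.* k)

    2kk≡k[2k] : 2 ℕ.* k ℕ.* k ≡ k ℕ.* (2 ℕ.* k)
    2kk≡k[2k] = ℕₚ.*-comm (2 ℕ.* k) k

    R<2k : R < 2 ℕ.* k
    R<2k = DivMod.m%n<n r (2 ℕ.* k)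

    Q≤k : Q ≤ k
    Q≤k = ℕₚ.*-cancelʳ-≤ Q k (2 ℕ.* k)
            (ℕₚ.≤-trans (DivMod.m/n*n≤m r (2 ℕ.* k)) (ℕₚ.≤-trans r≤2k² (ℕₚ.≤-reflexive 2kk≡k[2k])))

    by-quotient : Q < k ⊎ Q ≡ k → ShortRepresentation k (+ r)
    by-quotient (inj₁ Q<k) with t , 1+Q+t≡k ← ℕₚ.m≤n⇒∃[o]m+o≡n Q<k
      with c , ‖c‖≤k , c↦R+2kQ ← ≡.subst (λ k′ → ShortRepresentation k′ (+ R + + Q * (+ 2 * + k′))) 1+Q+t≡k
                                   (short-code-for-R+2kQ Q R t (≡.subst (λ k′ → R < 2 ℕ.* k′) (≡.sym 1+Q+t≡k) R<2k))
      = c , ‖c‖≤k , ≡.trans c↦R+2kQ (≡.trans (cong (λ z → + R + + Q * z) (≡.sym (ℤₚ.pos-* 2 k)))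
                                     (≡.trans (cong (_+_ (+ R)) (≡.sym (ℤₚ.pos-* Q (2 ℕ.* k)))) (cong +_ (≡.sym r≡R+Q[2k]))))
    by-quotient (inj₂ Q≡k) = code true (+ 0) (+ 0) , s≤s z≤n , cong +_ (begin
      2 ℕ.* k ℕ.* k ℕ.+ 0   ≡⟨ ℕₚ.+-identityʳ _ ⟩
      2 ℕ.* k ℕ.* k         ≡⟨ 2kk≡k[2k] ⟩
      k ℕ.* (2 ℕ.* k)       ≡⟨ cong (ℕ._* (2 ℕ.* k)) Q≡k ⟨
      Q ℕ.* (2 ℕ.* k)       ≡⟨ cong (ℕ._+ Q ℕ.* (2 ℕ.* k)) R≡0 ⟨
      R ℕ.+ Q ℕ.* (2 ℕ.* k) ≡⟨ r≡R+Q[2k] ⟨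
      r                     ∎)
      where
      open ≡-Reasoning
      R≡0 : R ≡ 0
      R≡0 = ℕₚ.n≤0⇒n≡0 (ℕₚ.+-cancelʳ-≤ (Q ℕ.* (2 ℕ.* k)) R 0
              (ℕₚ.≤-trans (ℕₚ.≤-reflexive (≡.sym r≡R+Q[2k]))
              (ℕₚ.≤-trans r≤2k² (ℕₚ.≤-reflexive (≡.trans 2kk≡k[2k] (cong (ℕ._* (2 ℕ.* k)) (≡.sym Q≡k)))))))

  module Graph (m : ℕ) where
    k N : ℕ
    k = 2 ℕ.+ m
    N = 4 ℕ.* k ℕ.* k

    G : AbelianGroup _ _
    G = ℤ-mod-abelianGroup N

    open AbelianGroup G using (_≈_; ∙-congˡ; setoid)
    private module ≈-Reasoning = Relation.Binary.Reasoning.Setoid setoid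
    open Cayley G using (gen; IsInvolution; Admissible; DistLe; HasDiameter)

    B A : ℤ
    B = + (2 ℕ.* k ℕ.* k)
    A = + (2 ℕ.* k ∸ 1)

    gens : Fin 5 → ℤ
    gens = gen B (+ 1) A

    private
      A≡3+2m : A ≡ + (3 ℕ.+ 2 ℕ.* m)
      A≡3+2m = cong +_ (expand m)
        where
        expand : ∀ m → suc (m ℕ.+ (suc (suc m) ℕ.+ 0)) ≡ 3 ℕ.+ 2 ℕ.* m
        expand = ℕ-Ring.solve-∀

      1≢A : + 1 ≢ A
      1≢A 1≡A with () ← ≡.trans 1≡A A≡3+2m

      <-by-gap : ∀ {a b} d → a ℕ.+ suc d ≡ b → a < b
      <-by-gap {a} d a+1+d≡b = ≡.subst (a <_) a+1+d≡b (ℕₚ.m<m+n a (s≤s z≤n))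

      ∣A∣<∣B∣ : ∣ A ∣ < ∣ B ∣
      ∣A∣<∣B∣ = ≡.subst (_< ∣ B ∣) (≡.sym (cong ∣_∣ A≡3+2m)) (<-by-gap (2 ℕ.* m ℕ.* m ℕ.+ 6 ℕ.* m ℕ.+ 4) (gap m))
        where
        gap : ∀ m → 3 ℕ.+ 2 ℕ.* m ℕ.+ suc (2 ℕ.* m ℕ.* m ℕ.+ 6 ℕ.* m ℕ.+ 4) ≡ 2 ℕ.* (2 ℕ.+ m) ℕ.* (2 ℕ.+ m)
        gap = ℕ-Ring.solve-∀

      ∣B∣+∣A∣<N : ∣ B ∣ ℕ.+ ∣ A ∣ < N
      ∣B∣+∣A∣<N = ≡.subst (λ a → ∣ B ∣ ℕ.+ a < N) (≡.sym (cong ∣_∣ A≡3+2m)) (<-by-gap (2 ℕ.* m ℕ.* m ℕ.+ 6 ℕ.* m ℕ.+ 4) (gap m))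
        where
        gap : ∀ m → 2 ℕ.* (2 ℕ.+ m) ℕ.* (2 ℕ.+ m) ℕ.+ (3 ℕ.+ 2 ℕ.* m) ℕ.+ suc (2 ℕ.* m ℕ.* m ℕ.+ 6 ℕ.* m ℕ.+ 4)
                  ≡ 4 ℕ.* (2 ℕ.+ m) ℕ.* (2 ℕ.+ m)
        gap = ℕ-Ring.solve-∀

    distinct : ∀ x y → ∣ x ∣ ℕ.+ ∣ y ∣ < N → x ≢ y → ¬ x ≈ y
    distinct x y small x≢y x≈y = x≢y (≡[mod]-injective (ℕₚ.≤-<-trans (ℤₚ.∣i-j∣≤∣i∣+∣j∣ x y) small) x≈y)

    private
      ∣gens∣≤∣A∣ : ∀ i → i ≢ 0F → ∣ gens i ∣ ≤ ∣ A ∣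
      ∣gens∣≤∣A∣ 0F 0≢0 = ⊥-elim (0≢0 refl)
      ∣gens∣≤∣A∣ 1F _   = s≤s z≤n
      ∣gens∣≤∣A∣ 2F _   = s≤s z≤n
      ∣gens∣≤∣A∣ 3F _   = ℕₚ.≤-refl
      ∣gens∣≤∣A∣ 4F _   = ℕₚ.≤-reflexive (ℤₚ.∣-i∣≡∣i∣ A)

      ∣gens∣≤∣B∣ : ∀ i → ∣ gens i ∣ ≤ ∣ B ∣
      ∣gens∣≤∣B∣ 0F          = ℕₚ.≤-refl
      ∣gens∣≤∣B∣ i@(Fin.suc _) = ℕₚ.≤-trans (∣gens∣≤∣A∣ i (λ ())) (ℕₚ.<⇒≤ ∣A∣<∣B∣)

      gens-pair-small : ∀ {i j} → i ≢ j → ∣ gens i ∣ ℕ.+ ∣ gens j ∣ < N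
      gens-pair-small {0F} {j} 0≢j = ℕₚ.≤-<-trans (ℕₚ.+-monoʳ-≤ ∣ B ∣ (∣gens∣≤∣A∣ j (0≢j ∘ ≡.sym))) ∣B∣+∣A∣<N
      gens-pair-small {i@(Fin.suc _)} {j} _ = ℕₚ.≤-<-trans
        (ℕₚ.≤-trans (ℕₚ.+-mono-≤ (∣gens∣≤∣A∣ i (λ ())) (∣gens∣≤∣B∣ j)) (ℕₚ.≤-reflexive (ℕₚ.+-comm ∣ A ∣ ∣ B ∣)))
        ∣B∣+∣A∣<N

      gens-injectiveℤ : ∀ i j → gens i ≡ gens j → i ≡ j
      gens-injectiveℤ 0F 0F _     = refl
      gens-injectiveℤ 0F 1F ()
      gens-injectiveℤ 0F 2F ()
      gens-injectiveℤ 0F 3F B≡A   = ⊥-elim (ℕₚ.<⇒≢ ∣A∣<∣B∣ (≡.sym (cong ∣_∣ B≡A)))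
      gens-injectiveℤ 0F 4F ()
      gens-injectiveℤ 1F 0F ()
      gens-injectiveℤ 1F 1F _     = refl
      gens-injectiveℤ 1F 2F ()
      gens-injectiveℤ 1F 3F 1≡A   = ⊥-elim (1≢A 1≡A)
      gens-injectiveℤ 1F 4F ()
      gens-injectiveℤ 2F 0F ()
      gens-injectiveℤ 2F 1F ()
      gens-injectiveℤ 2F 2F _     = refl
      gens-injectiveℤ 2F 3F ()
      gens-injectiveℤ 2F 4F -1≡-A = ⊥-elim (1≢A (ℤₚ.neg-injective -1≡-A))
      gens-injectiveℤ 3F 0F A≡B   = ⊥-elim (ℕₚ.<⇒≢ ∣A∣<∣B∣ (cong ∣_∣ A≡B))
      gens-injectiveℤ 3F 1F A≡1   = ⊥-elim (1≢A (≡.sym A≡1))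
      gens-injectiveℤ 3F 2F ()
      gens-injectiveℤ 3F 3F _     = refl
      gens-injectiveℤ 3F 4F ()
      gens-injectiveℤ 4F 0F ()
      gens-injectiveℤ 4F 1F ()
      gens-injectiveℤ 4F 2F -A≡-1 = ⊥-elim (1≢A (≡.sym (ℤₚ.neg-injective -A≡-1)))
      gens-injectiveℤ 4F 3F ()
      gens-injectiveℤ 4F 4F _     = refl

    gens-injective : ∀ i j → gens i ≈ gens j → i ≡ j
    gens-injective i j gi≈gj with i Fin.≟ j
    ... | yes i≡j = i≡j
    ... | no  i≢j = ⊥-elim (distinct (gens i) (gens j) (gens-pair-small i≢j) (i≢j ∘ gens-injectiveℤ i j) gi≈gj)

    B+B≈0 : B + B ≈ + 0
    B+B≈0 = + 1 , ≡.trans (cong +_ (double k)) (≡.sym (≡.trans (ℤₚ.+-identityˡ _) (ℤₚ.*-identityˡ _)))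
      where
      double : ∀ k → 2 ℕ.* k ℕ.* k ℕ.+ 2 ℕ.* k ℕ.* k ≡ 4 ℕ.* k ℕ.* k
      double = ℕ-Ring.solve-∀

    admissible : Admissible B (+ 1) A
    admissible = (distinct B (+ 0) ∣B∣+0<N (λ ()) , B+B≈0)
               , (λ (_ , 2≈0) → distinct (+ 2) (+ 0) 2<N (λ ()) 2≈0)
               , (λ (_ , 2A≈0) → distinct (A + A) (+ 0) ∣2A∣+0<N (λ ()) 2A≈0)
               , gens-injective
      where
      ∣B∣+0<N : ∣ B ∣ ℕ.+ 0 < N
      ∣B∣+0<N = ℕₚ.≤-<-trans (ℕₚ.+-monoʳ-≤ ∣ B ∣ z≤n) ∣B∣+∣A∣<N
      2<N : 2 < N
      2<N = ℕₚ.≤-<-trans (ℕₚ.≤-trans (≡.subst (2 ≤_) (≡.sym (cong ∣_∣ A≡3+2m)) (s≤s (s≤s z≤n)))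
                                     (ℕₚ.m≤n+m ∣ A ∣ ∣ B ∣)) ∣B∣+∣A∣<N
      ∣2A∣+0<N : ∣ A + A ∣ ℕ.+ 0 < N
      ∣2A∣+0<N = ℕₚ.≤-<-trans (ℕₚ.≤-reflexive (ℕₚ.+-identityʳ _))
                   (ℕₚ.≤-<-trans (ℕₚ.+-monoˡ-≤ ∣ A ∣ (ℕₚ.<⇒≤ ∣A∣<∣B∣)) ∣B∣+∣A∣<N)

    open IntegerMultiples G using (_·_)
    open Evaluation G B (+ 1) A B+B≈0 using (val; val-⊖; DistLe⇒code; code⇒DistLe)

    private
      +·≡* : ∀ n g → (+ n) · g ≡ + n * g
      +·≡* zero    g = ≡.sym (ℤₚ.*-zeroˡ g)
      +·≡* (suc n) g = ≡.trans (cong (_+_ g) (+·≡* n g)) (one-more (+ n) g)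
        where
        one-more : ∀ n g → g + n * g ≡ (+ 1 + n) * g
        one-more = ℤ-Ring.solve-∀

      ·≡* : ∀ i g → i · g ≡ i * g
      ·≡* (+ n)    g = +·≡* n g
      ·≡* -[1+ n ] g = ≡.trans (cong -_ (+·≡* (suc n) g)) (ℤₚ.neg-distribˡ-* (+ suc n) g)

      coefficients : ∀ x y → x · + 1 + y · A ≡ x + y * A
      coefficients x y = cong₂ _+_ (≡.trans (·≡* x (+ 1)) (ℤₚ.*-identityʳ x)) (·≡* y A)

    val≡codeValue : ∀ c → val c ≡ codeValue k c
    val≡codeValue (code false x y) = cong (_+_ (+ 0)) (coefficients x y)
    val≡codeValue (code true  x y) = cong (_+_ B) (coefficients x y)

    private
      K : ℤ
      K = + k

      A≡2K-1 : A ≡ + 2 * K - + 1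
      A≡2K-1 = pos-2k∸1 (suc m)

      B≡2KK : B ≡ + 2 * K * K
      B≡2KK = pos-2kk k

      N≡4KK : + N ≡ + 4 * K * K
      N≡4KK = ≡.trans (ℤₚ.pos-* (4 ℕ.* k) k) (cong (_* K) (ℤₚ.pos-* 4 k))

      1+2z≢0 : ∀ z → + 1 + + 2 * z ≢ + 0
      1+2z≢0 z 1+2z≡0 = ℕₚ.even≢odd ∣ z ∣ 0 (≡.sym (begin
        ∣ + 1 ∣                       ≡⟨ cong ∣_∣ (move (+ 2 * z)) ⟩
        ∣ + 1 + + 2 * z - + 2 * z ∣   ≡⟨ cong (λ w → ∣ w - + 2 * z ∣) 1+2z≡0 ⟩
        ∣ + 0 - + 2 * z ∣             ≡⟨ cong ∣_∣ (ℤₚ.+-identityˡ (- (+ 2 * z))) ⟩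
        ∣ - (+ 2 * z) ∣               ≡⟨ ℤₚ.∣-i∣≡∣i∣ (+ 2 * z) ⟩
        ∣ + 2 * z ∣                   ≡⟨ ℤₚ.∣i*j∣≡∣i∣*∣j∣ (+ 2) z ⟩
        2 ℕ.* ∣ z ∣                   ∎))
        where
        open ≡-Reasoning
        move : ∀ w → + 1 ≡ + 1 + w - w
        move = ℤ-Ring.solve-∀

      k≤∣k[1+2z]∣ : ∀ z → k ≤ ∣ K * (+ 1 + + 2 * z) ∣
      k≤∣k[1+2z]∣ z = ≡.subst (k ≤_) (≡.sym (ℤₚ.∣i*j∣≡∣i∣*∣j∣ K (+ 1 + + 2 * z)))
        (ℕₚ.m≤m*n k ∣ + 1 + + 2 * z ∣ {{ℕ.≢-nonZero (1+2z≢0 z ∘ ℤₚ.∣i∣≡0⇒i≡0)}})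

      -- Modulo 2k, the value of a code is x - y, because 2k² ≡ 0 and 2k - 1 ≡ -1.
      x-y-odd-multiple : ∀ e x y q → codeValue k (code e x y) ≡ K + q * + N → ∃[ z ] x - y ≡ K * (+ 1 + + 2 * z)
      x-y-odd-multiple false x y q v≡k+qN = + 2 * K * q - y , (begin
        x - y                                                  ≡⟨ ring₁ x y K ⟩
        + 0 + (x + y * (+ 2 * K - + 1)) - + 2 * K * y          ≡⟨ cong (λ a → + 0 + (x + y * a) - + 2 * K * y) A≡2K-1 ⟨
        codeValue k (code false x y) - + 2 * K * y             ≡⟨ cong (_- + 2 * K * y) v≡k+qN ⟩
        K + q * + N - + 2 * K * y                              ≡⟨ cong (λ n → K + q * n - + 2 * K * y) N≡4KK ⟩
        K + q * (+ 4 * K * K) - + 2 * K * y                    ≡⟨ ring₂ y q K ⟩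
        K * (+ 1 + + 2 * (+ 2 * K * q - y))                    ∎)
        where
        open ≡-Reasoning
        ring₁ : ∀ x y K → x - y ≡ + 0 + (x + y * (+ 2 * K - + 1)) - + 2 * K * y
        ring₁ = ℤ-Ring.solve-∀
        ring₂ : ∀ y q K → K + q * (+ 4 * K * K) - + 2 * K * y ≡ K * (+ 1 + + 2 * (+ 2 * K * q - y))
        ring₂ = ℤ-Ring.solve-∀
      x-y-odd-multiple true x y q v≡k+qN = + 2 * K * q - K - y , (begin
        x - y                                                  ≡⟨ ring₁ x y K ⟩
        + 2 * K * K + (x + y * (+ 2 * K - + 1)) - + 2 * K * y - + 2 * K * K
          ≡⟨ cong₂ (λ b a → b + (x + y * a) - + 2 * K * y - + 2 * K * K) B≡2KK A≡2K-1 ⟨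
        codeValue k (code true x y) - + 2 * K * y - + 2 * K * K ≡⟨ cong (λ v → v - + 2 * K * y - + 2 * K * K) v≡k+qN ⟩
        K + q * + N - + 2 * K * y - + 2 * K * K                ≡⟨ cong (λ n → K + q * n - + 2 * K * y - + 2 * K * K) N≡4KK ⟩
        K + q * (+ 4 * K * K) - + 2 * K * y - + 2 * K * K      ≡⟨ ring₂ y q K ⟩
        K * (+ 1 + + 2 * (+ 2 * K * q - K - y))                ∎)
        where
        open ≡-Reasoning
        ring₁ : ∀ x y K → x - y ≡ + 2 * K * K + (x + y * (+ 2 * K - + 1)) - + 2 * K * y - + 2 * K * K
        ring₁ = ℤ-Ring.solve-∀
        ring₂ : ∀ y q K → K + q * (+ 4 * K * K) - + 2 * K * y - + 2 * K * K ≡ K * (+ 1 + + 2 * (+ 2 * K * q - K - y))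
        ring₂ = ℤ-Ring.solve-∀

    no-short-code : ∀ c → ‖ c ‖ ≤ k ∸ 1 → ¬ (+ 0 + val c ≈ K)
    no-short-code (code e x y) ‖c‖≤k-1 (q , 0+c≡k+qN) = ℕₚ.1+n≰n (begin
      k                        ≤⟨ k≤∣k[1+2z]∣ z ⟩
      ∣ K * (+ 1 + + 2 * z) ∣  ≡⟨ cong ∣_∣ x-y≡k[1+2z] ⟨
      ∣ x - y ∣                ≤⟨ ℤₚ.∣i-j∣≤∣i∣+∣j∣ x y ⟩
      ‖ x , y ‖₁               ≤⟨ ‖x,y‖≤‖c‖ e ⟩
      ‖ code e x y ‖           ≤⟨ ‖c‖≤k-1 ⟩
      suc m                    ∎)
      where
      open ℕₚ.≤-Reasoning
      odd-multiple : ∃[ z ] x - y ≡ K * (+ 1 + + 2 * z)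
      odd-multiple = x-y-odd-multiple e x y q
        (≡.trans (≡.sym (val≡codeValue (code e x y))) (≡.trans (≡.sym (ℤₚ.+-identityˡ _)) 0+c≡k+qN))
      z : ℤ
      z = proj₁ odd-multiple
      x-y≡k[1+2z] : x - y ≡ K * (+ 1 + + 2 * z)
      x-y≡k[1+2z] = proj₂ odd-multiple
      ‖x,y‖≤‖c‖ : ∀ e → ‖ x , y ‖₁ ≤ ‖ code e x y ‖
      ‖x,y‖≤‖c‖ false = ℕₚ.≤-refl
      ‖x,y‖≤‖c‖ true  = ℕₚ.n≤1+n _

    no-short-path-to-k : ¬ DistLe gens (k ∸ 1) (+ 0) K
    no-short-path-to-k dist = let c , ‖c‖≤k-1 , 0+c≈k = DistLe⇒code {k ∸ 1} {+ 0} {K} dist in no-short-code c ‖c‖≤k-1 0+c≈k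

    short-code : ∀ t → ∃[ c ] (‖ c ‖ ≤ k × val c ≈ t)
    short-code t = by-size (r ℕ.≤? 2 ℕ.* k ℕ.* k)
      where
      open ≈-Reasoning
      r : ℕ
      r = t ℤ.%ℕ N

      by-size : Dec (r ≤ 2 ℕ.* k ℕ.* k) → ∃[ c ] (‖ c ‖ ≤ k × val c ≈ t)
      by-size (yes r≤2k²) =
        let c , ‖c‖≤k , c↦r = represent k r r≤2k² in
        c , ‖c‖≤k , (begin
          val c          ≡⟨ val≡codeValue c ⟩
          codeValue k c  ≡⟨ c↦r ⟩
          + r            ≈⟨ ≡[mod]-residue N t ⟨
          t              ∎)
      by-size (no  r≰2k²) =
        let c , ‖c‖≤k , c↦N-r = represent k (N ∸ r) N-r≤2k² in
        ⊖ c , ≡.subst (_≤ k) (≡.sym (‖⊖‖ c)) ‖c‖≤k , (begin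
          val (⊖ c)        ≈⟨ val-⊖ c ⟩
          - val c          ≡⟨ cong -_ (val≡codeValue c) ⟩
          - codeValue k c  ≡⟨ cong -_ c↦N-r ⟩
          - + (N ∸ r)      ≈⟨ ≡[mod]-complement (ℕₚ.<⇒≤ (ℤ-DivMod.n%ℕd<d t N)) ⟩
          + r              ≈⟨ ≡[mod]-residue N t ⟨
          t                ∎)
        where
        N-r≤2k² : N ∸ r ≤ 2 ℕ.* k ℕ.* k
        N-r≤2k² = ℕₚ.m≤n+o⇒m∸n≤o N r
          (ℕₚ.≤-trans (ℕₚ.≤-reflexive (halves k)) (ℕₚ.+-monoˡ-≤ (2 ℕ.* k ℕ.* k) (ℕₚ.<⇒≤ (ℕₚ.≰⇒> r≰2k²))))
          where
          halves : ∀ k → 4 ℕ.* k ℕ.* k ≡ 2 ℕ.* k ℕ.* k ℕ.+ 2 ℕ.* k ℕ.* k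
          halves = ℕ-Ring.solve-∀

    diameter : HasDiameter gens k
    diameter = reach , + 0 , K , no-short-path-to-k
      where
      open ≈-Reasoning
      cancel : ∀ u v → u + (v - u) ≡ v
      cancel = ℤ-Ring.solve-∀
      reach : ∀ u v → DistLe gens k u v
      reach u v = let c , ‖c‖≤k , c≈v-u = short-code (v - u) in
        code⇒DistLe {k} {u} {v} c ‖c‖≤k (begin
          u + val c        ≈⟨ ∙-congˡ {u} {val c} {v - u} c≈v-u ⟩
          u + (v - u)      ≡⟨ cancel u v ⟩
          v                ∎)

open import Defs
open import Level using (Level)
open import Data.Nat using (ℕ; _≤_; _*_; _∸_; suc; s≤s)
open import Data.Integer using (+_)
open import Data.Product using (_×_; _,_; proj₁)
open FiniteAbelianGroup using (abGroup; Carrier; order)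
open UpperBound using (order≤4k²)
open Extremal using (module Graph)

proposition3p1 : ∀ {c ℓ : Level} (k : ℕ) → 2 ≤ k →
    -- upper bound: every admissible Cay(Γ,{b,±a₁,±a₂}) of diameter k has |Γ| ≤ 4k²
    ((Γ : FiniteAbelianGroup c ℓ) (b a₁ a₂ : Carrier Γ) →
      Cayley.Admissible (abGroup Γ) b a₁ a₂ →
      Cayley.HasDiameter (abGroup Γ) (Cayley.gen (abGroup Γ) b a₁ a₂) k →
      order Γ ≤ 4 * k * k)
    ×
    -- attained: Cay(ℤ_N, {±1, ±(2k-1), 2k²}) with N = 4k² is admissible of diameter k
    (Cayley.Admissible (ℤ-mod-abelianGroup (4 * k * k))
       (+ (2 * k * k)) (+ 1) (+ (2 * k ∸ 1))
     ×
     Cayley.HasDiameter (ℤ-mod-abelianGroup (4 * k * k))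
       (Cayley.gen (ℤ-mod-abelianGroup (4 * k * k)) (+ (2 * k * k)) (+ 1) (+ (2 * k ∸ 1)))
       k)
-- The bound only uses that b is an involution and that every distance is at most k.
proposition3p1 .(suc (suc m)) (s≤s (s≤s {n = m} _)) =
  (λ Γ b a₁ a₂ admissible diameter → order≤4k² Γ m (proj₁ admissible) (proj₁ diameter)) ,
  Graph.admissible m , Graph.diameter m
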